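{- Let $\alpha\in\{231,312\}$ and let $i_n^k(\emptyset;\alpha)$ be the number of involutions of $\{1,\dots,n\}$ with exactly $k$ fixed points that contain the pattern $\alpha$ exactly once. For $n\geq 4$ and $0\leq k\leq n$, $$i_n^k(\emptyset;\alpha)=\begin{cases}(k-1)2^{\frac{n-k-6}{2}}\left(\binom{\frac{n+k}{2}-2}{\frac{n-k}{2}-1}+2\binom{\frac{n+k}{2}-3}{\frac{n-k}{2}-1}+\binom{\frac{n+k}{2}-4}{\frac{n-k}{2}-1}\right) & \text{if } n+k \text{ is even},\\ 0 & \text{if } n+k \text{ is odd}.\end{cases}$$
   Context: An involution is a permutation with $\pi^{ -1}=\pi$; a fixed point is an $i$ with $\pi_i=i$. An occurrence of a pattern $\alpha\in S_m$ in $\pi\in S_n$ (one-line notation) is a set of indices $i_1<\dots<i_m$ such that $\pi_{i_1}\cdots\pi_{i_m}$ is order-isomorphic to $\alpha$; $\pi$ contains $\alpha$ exactly once if there is exactly one such occurrence. Binomial coefficients $\binom{a}{b}$ with integers $a,b$ are taken as $1$ if $b=0$ (for every integer $a$, including negative $a$) and $0$ if $b<0$ or $b>0$ with $b>a$. -}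

module Defs where

open import Data.Nat as ℕ using (ℕ; zero; suc; _∸_; _+_; _*_; _^_)
open import Data.Nat.Combinatorics using (_C_)
open import Data.Nat.DivMod using (_/_)
open import Data.Fin using (Fin; zero; suc)
open import Data.Fin.Properties using (_≟_; _<?_)
open import Data.Vec using (Vec; []; _∷_; lookup; map)
import Data.List as L
open L using (List; length; filterᵇ; concatMap; allFin)
open import Data.Bool using (Bool; true; false; _∧_; _∨_; not)
import Data.Bool.Properties as BP
open import Relation.Nullary.Decidable using (⌊_⌋)
open import Data.Integer as ℤ using (ℤ; +_; -[1+_])
import Data.Rational as ℚ
open ℚ using (ℚ)

allB : {n : ℕ} → (Fin n → Bool) → Bool
allB {n} p = L.foldr (λ i b → p i ∧ b) true (allFin n)

words : (m n : ℕ) → List (Vec (Fin n) m)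
words zero n = L.[ [] ]
words (suc m) n = concatMap (λ v → L.map (λ i → i ∷ v) (allFin n)) (words m n)

-- A permutation of {1..n} in one-line notation is a word π ∈ Vec (Fin n) n
-- (0-based values/positions). A word with π(π(i)) = i for all i is
-- automatically a bijection, hence an involution.
isInvolution : {n : ℕ} → Vec (Fin n) n → Bool
isInvolution π = allB (λ i → ⌊ lookup π (lookup π i) ≟ i ⌋)

involutions : (n : ℕ) → List (Vec (Fin n) n)
involutions n = filterᵇ isInvolution (words n n)

fixedPoints : {n : ℕ} → Vec (Fin n) n → ℕ
fixedPoints {n} π = length (filterᵇ (λ i → ⌊ lookup π i ≟ i ⌋) (allFin n))

strictlyIncreasing : {m n : ℕ} → Vec (Fin n) m → Bool
strictlyIncreasing idx =
  allB (λ j → allB (λ l → not ⌊ j <? l ⌋ ∨ ⌊ lookup idx j <? lookup idx l ⌋))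

orderIso : {m n p : ℕ} → Vec (Fin n) m → Vec (Fin p) m → Bool
orderIso w α =
  allB (λ j → allB (λ l →
    ⌊ BP._≟_ ⌊ lookup w j <? lookup w l ⌋ ⌊ lookup α j <? lookup α l ⌋ ⌋))

occurrences : {m n : ℕ} → Vec (Fin m) m → Vec (Fin n) n → ℕ
occurrences {m} {n} α π =
  length (filterᵇ (λ idx → strictlyIncreasing idx ∧ orderIso (map (lookup π) idx) α)
                  (words m n))

invCount : {m : ℕ} → (n k : ℕ) → Vec (Fin m) m → ℕ
invCount n k α =
  length (filterᵇ (λ π → ⌊ fixedPoints π ℕ.≟ k ⌋ ∧ ⌊ occurrences α π ℕ.≟ 1 ⌋)
                  (involutions n))

p231 : Vec (Fin 3) 3
p231 = suc zero ∷ suc (suc zero) ∷ zero ∷ []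

p312 : Vec (Fin 3) 3
p312 = suc (suc zero) ∷ zero ∷ suc zero ∷ []

-- binomial coefficient with the paper's convention for integer arguments:
-- 1 if b = 0 (any a), 0 if b < 0, 0 if b > 0 and b > a, else the usual a C b
binom : ℤ → ℤ → ℕ
binom a (+ zero) = 1
binom a -[1+ _ ] = 0
binom (+ a) (+ suc b) = a C suc b
binom -[1+ _ ] (+ suc b) = 0

halfPow : ℕ → ℚ
halfPow zero = ℚ.1ℚ
halfPow (suc m) = ℚ.½ ℚ.* halfPow m

pow2 : ℤ → ℚ
pow2 (+ e) = + (2 ^ e) ℚ./ 1
pow2 -[1+ m ] = halfPow (suc m)

ℕtoℚ : ℕ → ℚ
ℕtoℚ x = + x ℚ./ 1

ℤtoℚ : ℤ → ℚ
ℤtoℚ x = x ℚ./ 1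

formulaEven : ℕ → ℕ → ℚ
formulaEven n k =
  ℤtoℚ (+ k ℤ.- + 1) ℚ.* pow2 (+ ((n ∸ k) / 2) ℤ.- + 3)
    ℚ.* ℕtoℚ (binom (s ℤ.- + 2) h + 2 * binom (s ℤ.- + 3) h + binom (s ℤ.- + 4) h)
  where
    s : ℤ
    s = + ((n + k) / 2)
    h : ℤ
    h = + ((n ∸ k) / 2) ℤ.- + 1

-- An involution with exactly one occurrence of 231 is a direct sum of blocks: reversals of
-- intervals of consecutive points, and exactly one block 4231. Let v = g s be the partner of
-- the first point s. If g sent a point of (s, v) above v there would be two occurrences, so
-- g maps (s, v) into itself; there it is either decreasing, making [s, v] a reversal block,
-- or it has a unique ascent, and the involution property then makes [s, v] the block 4231.
-- For an involution, (a , b , c) ↦ (g b , g c , g a) maps the occurrences of 312 bijectively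
-- onto those of 231, so both patterns give the same count.
--
-- A reversal of r + 1 points has ⌈r / 2⌉ two-cycles and a fixed point iff r is even.
-- Counting block sequences by their numbers p + 1 of two-cycles and q + 1 of fixed points
-- gives q times the coefficient of x^p y^q in (1 − x)² / (1 − 2x − y), and the Pascal rule
-- turns this into the binomial expression of the theorem.

module Submission where

open import Defs

open import Data.Bool using (Bool; true; false; T; T?; not; _∧_; _∨_; if_then_else_)
import Data.Bool.Properties as Bool
open import Data.Empty using (⊥; ⊥-elim)
open import Data.Fin as Fin using (Fin; toℕ; fromℕ<)
open import Data.Fin.Patterns using (0F; 1F; 2F)
import Data.Fin.Properties as Fin
import Data.Integer as ℤ
import Data.Integer.Properties as ℤ
open import Data.List
  using (List; []; _∷_; _++_; map; length; filterᵇ; tabulate; allFin; concatMap; cartesianProductWith)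
open import Data.List.Membership.Propositional using (_∈_)
open import Data.List.Membership.Propositional.Properties
  using (∈-map⁺; ∈-map⁻; ∈-++⁺ˡ; ∈-++⁺ʳ; ∈-++⁻; ∈-filter⁺; ∈-filter⁻; ∈-allFin; ∈-cartesianProductWith⁺)
open import Data.List.Membership.Propositional.Properties.WithK using (unique∧set⇒bag)
import Data.List.Properties as List
open import Data.List.Properties using (length-map; length-++)
open import Data.List.Relation.Binary.BagAndSetEquality using (∼bag⇒↭)
open import Data.List.Relation.Binary.Permutation.Propositional.Properties using (↭-length)
open import Data.List.Relation.Unary.All using ([])
import Data.List.Relation.Unary.All as All
open import Data.List.Relation.Unary.AllPairs using ([]; _∷_)
open import Data.List.Relation.Unary.Any using (here; there)
open import Data.List.Relation.Unary.Unique.Propositional using (Unique)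
import Data.List.Relation.Unary.Unique.Propositional.Properties as Unique
open import Data.Nat
open import Data.Nat.Combinatorics using (_C_; nCk+nC[k+1]≡[n+1]C[k+1]; nCn≡1; nC1≡n; nCk≡nC[n∸k]; k>n⇒nCk≡0)
import Data.Nat.Coprimality as Coprime
open import Data.Nat.DivMod using (_%_; _/_; m≡m%n+[m/n]*n; [m+kn]%n≡m%n; m*n/n≡m; m*n%n≡0)
open import Data.Nat.Induction using (<-wellFounded)
open import Data.Nat.ListAction using (sum)
open import Data.Nat.Properties
open import Data.Nat.Tactic.RingSolver using (solve-∀)
open import Data.Product using (Σ; ∃; ∃-syntax; ∃!; _×_; _,_; proj₁; proj₂; uncurry; swap)
import Data.Rational as ℚ
import Data.Rational.Properties as ℚ
open import Data.Sum using (_⊎_; inj₁; inj₂; [_,_]′)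
import Data.Sum as ⊎
open import Data.Unit using (⊤; tt)
open import Data.Vec as Vec using (Vec; []; _∷_; lookup)
import Data.Vec.Properties as Vec
open import Function using (_∘_)
open import Function.Bundles using (_⇔_; mk⇔; Equivalence)
open import Function.Construct.Composition using (_⇔-∘_)
open import Induction.WellFounded using (Acc; acc)
open import Relation.Binary.Definitions using (tri<; tri≈; tri>)
open import Relation.Binary.PropositionalEquality
open import Relation.Nullary using (¬_; Dec; yes; no; contradiction)
open import Relation.Nullary.Decidable using (⌊_⌋; toWitness; fromWitness)

-- Involutions of an interval and their occurrences of 231

record InvolutionOn (s n : ℕ) (g : ℕ → ℕ) : Set where
  field
    lower      : ∀ {i} → s ≤ i → i < n → s ≤ g i
    upper      : ∀ {i} → s ≤ i → i < n → g i < n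
    involutive : ∀ {i} → s ≤ i → i < n → g (g i) ≡ i

  injective : ∀ {i j} → s ≤ i → i < n → s ≤ j → j < n → g i ≡ g j → i ≡ j
  injective s≤i i<n s≤j j<n eq =
    trans (sym (involutive s≤i i<n)) (trans (cong g eq) (involutive s≤j j<n))

open InvolutionOn

AgreeOn : ℕ → ℕ → (ℕ → ℕ) → (ℕ → ℕ) → Set
AgreeOn s n g h = ∀ {i} → s ≤ i → i < n → g i ≡ h i

Triple : Set
Triple = ℕ × ℕ × ℕ

data Occ231 (s n : ℕ) (g : ℕ → ℕ) : Triple → Set where
  occ : ∀ {a b c} → s ≤ a → a < b → b < c → c < n → g c < g a → g a < g b →
        Occ231 s n g (a , b , c)

Avoids231 : ℕ → ℕ → (ℕ → ℕ) → Set
Avoids231 s n g = ∀ {t} → ¬ Occ231 s n g t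

AtMostOne231 : ℕ → ℕ → (ℕ → ℕ) → Set
AtMostOne231 s n g = ∀ {t u} → Occ231 s n g t → Occ231 s n g u → t ≡ u

Unique231 : ℕ → ℕ → (ℕ → ℕ) → Set
Unique231 s n g = ∃! _≡_ (Occ231 s n g)

module _ {s n : ℕ} {g : ℕ → ℕ} where

  InvolutionOn-cong : ∀ {h} → AgreeOn s n g h → InvolutionOn s n g → InvolutionOn s n h
  InvolutionOn-cong {h} g≗h inv = record
    { lower = λ s≤i i<n → subst (s ≤_) (g≗h s≤i i<n) (lower inv s≤i i<n)
    ; upper = λ s≤i i<n → subst (_< n) (g≗h s≤i i<n) (upper inv s≤i i<n)
    ; involutive = λ {i} s≤i i<n → begin
        h (h i)  ≡⟨ cong h (sym (g≗h s≤i i<n)) ⟩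
        h (g i)  ≡⟨ sym (g≗h (lower inv s≤i i<n) (upper inv s≤i i<n)) ⟩
        g (g i)  ≡⟨ involutive inv s≤i i<n ⟩
        i        ∎
    }
    where open ≡-Reasoning

  Occ231-cong : ∀ {h t} → AgreeOn s n g h → Occ231 s n g t → Occ231 s n h t
  Occ231-cong g≗h (occ s≤a a<b b<c c<n gc<ga ga<gb) =
    occ s≤a a<b b<c c<n (subst₂ _<_ (g≗h s≤c c<n) (g≗h s≤a a<n) gc<ga)
                        (subst₂ _<_ (g≗h s≤a a<n) (g≗h s≤b b<n) ga<gb)
    where
    s≤b = ≤-trans s≤a (<⇒≤ a<b)
    s≤c = ≤-trans s≤b (<⇒≤ b<c)
    b<n = <-trans b<c c<n
    a<n = <-trans a<b b<n

  Occ231-widen : ∀ {s′ n′ t} → s ≤ s′ → n′ ≤ n → Occ231 s′ n′ g t → Occ231 s n g t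
  Occ231-widen s≤s′ n′≤n (occ s′≤a a<b b<c c<n′ gc<ga ga<gb) =
    occ (≤-trans s≤s′ s′≤a) a<b b<c (<-≤-trans c<n′ n′≤n) gc<ga ga<gb

  AgreeOn-glue : ∀ {t h} → AgreeOn s t g h → AgreeOn t n g h → AgreeOn s n g h
  AgreeOn-glue {t} left right {i} s≤i i<n with i <? t
  ... | yes i<t = left s≤i i<t
  ... | no  i≮t = right (≮⇒≥ i≮t) i<n

  module _ {t : ℕ} (s≤t : s ≤ t) (closed : ∀ {i} → s ≤ i → i < t → g i < t) where

    involution-rest : InvolutionOn s n g → InvolutionOn t n g
    involution-rest inv = record
      { lower      = t≤g
      ; upper      = λ t≤i → upper inv (≤-trans s≤t t≤i)
      ; involutive = λ t≤i → involutive inv (≤-trans s≤t t≤i)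
      }
      where
      t≤g : ∀ {i} → t ≤ i → i < n → t ≤ g i
      t≤g t≤i i<n = ≮⇒≥ λ gi<t →
        <⇒≱ (subst (_< t) (involutive inv s≤i i<n) (closed (lower inv s≤i i<n) gi<t)) t≤i
        where s≤i = ≤-trans s≤t t≤i

    Occ231-split : ∀ {u} → InvolutionOn s n g → Occ231 s n g u → Occ231 s t g u ⊎ Occ231 t n g u
    Occ231-split {a , b , c} inv (occ s≤a a<b b<c c<n gc<ga ga<gb) with c <? t
    ... | yes c<t = inj₁ (occ s≤a a<b b<c c<t gc<ga ga<gb)
    ... | no  c≮t = inj₂ (occ t≤a a<b b<c c<n gc<ga ga<gb)
      where
      t≤gc = lower (involution-rest inv) (≮⇒≥ c≮t) c<n
      t≤a : t ≤ a
      t≤a = ≮⇒≥ λ a<t → <-irrefl refl (<-trans (closed s≤a a<t) (≤-<-trans t≤gc gc<ga))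

  involution-glue : ∀ {t} → s ≤ t → t ≤ n → InvolutionOn s t g → InvolutionOn t n g → InvolutionOn s n g
  involution-glue {t} s≤t t≤n left right = record
    { lower      = λ {i} s≤i i<n →
        by-side i (lower left s≤i) (λ t≤i → ≤-trans s≤t (lower right t≤i i<n))
    ; upper      = λ {i} s≤i i<n →
        by-side i (λ i<t → <-≤-trans (upper left s≤i i<t) t≤n) (λ t≤i → upper right t≤i i<n)
    ; involutive = λ {i} s≤i i<n →
        by-side i (involutive left s≤i) (λ t≤i → involutive right t≤i i<n)
    }
    where
    by-side : ∀ {A : Set} i → (i < t → A) → (t ≤ i → A) → A
    by-side i below above with i <? t
    ... | yes i<t = below i<t
    ... | no  i≮t = above (≮⇒≥ i≮t)

occ-start<end : ∀ {s n g t} → Occ231 s n g t → s < n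
occ-start<end (occ s≤a a<b b<c c<n _ _) = ≤-<-trans s≤a (<-trans a<b (<-trans b<c c<n))

occ-start : ∀ {s n g a b c} → Occ231 s n g (a , b , c) → s ≤ a
occ-start (occ s≤a _ _ _ _ _) = s≤a

module _ {a b : ℕ} (h : ℕ → ℕ)
         (into : ∀ {i} → a < i → i < b → a < h i × h i < b)
         (decreasing : ∀ {i j} → a < i → i < j → j < b → h j < h i) where

  private
    reflection-≥ : ∀ k {i} → a < i → k + suc i ≡ b → a + b ≤ h i + i
    reflection-≥ zero {i} a<i refl = begin
      a + suc i  ≡⟨ +-suc a i ⟩
      suc a + i  ≤⟨ +-monoˡ-≤ i (proj₁ (into a<i ≤-refl)) ⟩
      h i + i    ∎
      where open ≤-Reasoning
    reflection-≥ (suc k) {i} a<i eq = begin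
      a + b                ≤⟨ reflection-≥ k (m<n⇒m<1+n a<i) (trans (+-suc k (suc i)) eq) ⟩
      h (suc i) + suc i    ≡⟨ +-suc (h (suc i)) i ⟩
      suc (h (suc i)) + i  ≤⟨ +-monoˡ-≤ i (decreasing a<i ≤-refl (subst (suc i <_) eq (s≤s (m≤n+m (suc i) k)))) ⟩
      h i + i              ∎
      where open ≤-Reasoning

    reflection-≤ : ∀ k {i} → k + suc a ≡ i → i < b → h i + i ≤ a + b
    reflection-≤ zero refl i<b = begin
      h (suc a) + suc a    ≡⟨ +-suc (h (suc a)) a ⟩
      suc (h (suc a)) + a  ≤⟨ +-monoˡ-≤ a (proj₂ (into ≤-refl i<b)) ⟩
      b + a                ≡⟨ +-comm b a ⟩
      a + b                ∎
      where open ≤-Reasoning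
    reflection-≤ (suc k) refl i<b = begin
      h (suc j) + suc j    ≡⟨ +-suc (h (suc j)) j ⟩
      suc (h (suc j)) + j  ≤⟨ +-monoˡ-≤ j (decreasing (m≤n+m (suc a) k) ≤-refl i<b) ⟩
      h j + j              ≤⟨ reflection-≤ k refl (<-trans (n<1+n j) i<b) ⟩
      a + b                ∎
      where
      open ≤-Reasoning
      j = k + suc a

  decreasing⇒reflection : ∀ {i} → a < i → i < b → h i + i ≡ a + b
  decreasing⇒reflection {i} a<i i<b = ≤-antisym
    (reflection-≤ (i ∸ suc a) (m∸n+n≡m a<i) i<b)
    (reflection-≥ (b ∸ suc i) a<i (m∸n+n≡m i<b))

-- Reversal blocks and the block 4231

-- g reverses [s, v], that is g i = s + v ∸ i there, stated without truncated subtraction.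
IsReversal : ℕ → ℕ → (ℕ → ℕ) → Set
IsReversal s v g = ∀ {i} → s ≤ i → i ≤ v → g i + i ≡ s + v

-- 4231 in 0-based one-line notation, as a map on the offsets 0 … 3 (junk beyond).
q4231 : ℕ → ℕ
q4231 0 = 3
q4231 1 = 1
q4231 2 = 2
q4231 _ = 0

Is4231 : ℕ → (ℕ → ℕ) → Set
Is4231 s g = ∀ {x} → x < 4 → g (x + s) ≡ q4231 x + s

is4231 : ∀ {s g} → g s ≡ 3 + s → g (1 + s) ≡ 1 + s → g (2 + s) ≡ 2 + s → g (3 + s) ≡ s → Is4231 s g
is4231 e₀ e₁ e₂ e₃ {x} x<4 with x | x<4
... | 0 | _ = e₀
... | 1 | _ = e₁
... | 2 | _ = e₂
... | 3 | _ = e₃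
... | suc (suc (suc (suc _))) | s≤s (s≤s (s≤s (s≤s ())))

-- rev r is the reversal of r + 1 consecutive points.
data Block : Set where
  rev   : ℕ → Block
  b4231 : Block

IsBlock : Block → ℕ → (ℕ → ℕ) → Set
IsBlock (rev r) s g = IsReversal s (s + r) g
IsBlock b4231   s g = Is4231 s g

ascent-in-4231 : ∀ {a b} → a < b → b < 4 → q4231 a < q4231 b → a ≡ 1 × b ≡ 2
ascent-in-4231 (s≤s z≤n) (s≤s (s≤s z≤n)) (s≤s ())
ascent-in-4231 (s≤s z≤n) (s≤s (s≤s (s≤s z≤n))) (s≤s (s≤s ()))
ascent-in-4231 (s≤s (s≤s z≤n)) (s≤s (s≤s (s≤s z≤n))) _ = refl , refl
ascent-in-4231 (s≤s z≤n) (s≤s (s≤s (s≤s (s≤s z≤n)))) ()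
ascent-in-4231 (s≤s (s≤s z≤n)) (s≤s (s≤s (s≤s (s≤s z≤n)))) ()
ascent-in-4231 (s≤s (s≤s (s≤s z≤n))) (s≤s (s≤s (s≤s (s≤s z≤n)))) ()

module _ {s v : ℕ} {g : ℕ → ℕ} (reversed : IsReversal s v g) where

  reversal-decreasing : ∀ {a b} → s ≤ a → a < b → b ≤ v → g b < g a
  reversal-decreasing {a} {b} s≤a a<b b≤v = +-cancelʳ-< b (g b) (g a) (begin-strict
    g b + b  ≡⟨ trans (reversed (≤-trans s≤a (<⇒≤ a<b)) b≤v) (sym (reversed s≤a (≤-trans (<⇒≤ a<b) b≤v))) ⟩
    g a + a  <⟨ +-monoʳ-< (g a) a<b ⟩
    g a + b  ∎)
    where open ≤-Reasoning

  reversal-involution : InvolutionOn s (suc v) g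
  reversal-involution = record { lower = lower′ ; upper = upper′ ; involutive = involutive′ }
    where
    lower′ : ∀ {i} → s ≤ i → i < suc v → s ≤ g i
    lower′ {i} s≤i i<1+v = +-cancelʳ-≤ i s (g i) (begin
      s + i    ≤⟨ +-monoʳ-≤ s (≤-pred i<1+v) ⟩
      s + v    ≡⟨ sym (reversed s≤i (≤-pred i<1+v)) ⟩
      g i + i  ∎)
      where open ≤-Reasoning
    upper′ : ∀ {i} → s ≤ i → i < suc v → g i < suc v
    upper′ {i} s≤i i<1+v = s≤s (+-cancelʳ-≤ s (g i) v (begin
      g i + s  ≤⟨ +-monoʳ-≤ (g i) s≤i ⟩
      g i + i  ≡⟨ reversed s≤i (≤-pred i<1+v) ⟩
      s + v    ≡⟨ +-comm s v ⟩
      v + s    ∎))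
      where open ≤-Reasoning
    involutive′ : ∀ {i} → s ≤ i → i < suc v → g (g i) ≡ i
    involutive′ {i} s≤i i<1+v = +-cancelˡ-≡ (g i) _ _ (begin
      g i + g (g i)  ≡⟨ +-comm (g i) (g (g i)) ⟩
      g (g i) + g i  ≡⟨ reversed (lower′ s≤i i<1+v) (≤-pred (upper′ s≤i i<1+v)) ⟩
      s + v          ≡⟨ sym (reversed s≤i (≤-pred i<1+v)) ⟩
      g i + i        ∎)
      where open ≡-Reasoning

  reversal-avoids : Avoids231 s (suc v) g
  reversal-avoids (occ s≤a a<b b<c c<1+v _ ga<gb) =
    <-asym ga<gb (reversal-decreasing s≤a a<b (≤-pred (<-trans b<c c<1+v)))

  reversal-unique : ∀ {h} → IsReversal s v h → AgreeOn s (suc v) g h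
  reversal-unique reversed′ {i} s≤i i<1+v =
    +-cancelʳ-≡ i _ _ (trans (reversed s≤i (≤-pred i<1+v)) (sym (reversed′ s≤i (≤-pred i<1+v))))

private
  offset : ∀ {s i} → s ≤ i → (i ∸ s) + s ≡ i
  offset = m∸n+n≡m

  offset-< : ∀ {s i k} → s ≤ i → i < s + k → i ∸ s < k
  offset-< {s} {i} {k} s≤i i<s+k = +-cancelʳ-< s (i ∸ s) k (subst₂ _<_ (sym (offset s≤i)) (+-comm s k) i<s+k)

  q4231-< : ∀ {x} → x < 4 → q4231 x < 4
  q4231-< {0} _ = s≤s (s≤s (s≤s (s≤s z≤n)))
  q4231-< {1} _ = s≤s (s≤s z≤n)
  q4231-< {2} _ = s≤s (s≤s (s≤s z≤n))
  q4231-< {3} _ = s≤s z≤n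
  q4231-< {suc (suc (suc (suc _)))} (s≤s (s≤s (s≤s (s≤s ()))))

  q4231-involutive : ∀ {x} → x < 4 → q4231 (q4231 x) ≡ x
  q4231-involutive {0} _ = refl
  q4231-involutive {1} _ = refl
  q4231-involutive {2} _ = refl
  q4231-involutive {3} _ = refl
  q4231-involutive {suc (suc (suc (suc _)))} (s≤s (s≤s (s≤s (s≤s ()))))

module _ {s : ℕ} {g : ℕ → ℕ} (block : Is4231 s g) where

  4231-value : ∀ {i} → s ≤ i → i < s + 4 → g i ≡ q4231 (i ∸ s) + s
  4231-value s≤i i<s+4 = trans (cong g (sym (offset s≤i))) (block (offset-< s≤i i<s+4))

  4231-involution : InvolutionOn s (s + 4) g
  4231-involution = record
    { lower = λ s≤i i<s+4 → subst (s ≤_) (sym (4231-value s≤i i<s+4)) (m≤n+m s _)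
    ; upper = λ s≤i i<s+4 → subst₂ _<_ (sym (4231-value s≤i i<s+4)) (+-comm 4 s)
                                        (+-monoˡ-< s (q4231-< (offset-< s≤i i<s+4)))
    ; involutive = λ {i} s≤i i<s+4 → let x<4 = offset-< s≤i i<s+4 in begin
        g (g i)                    ≡⟨ cong g (4231-value s≤i i<s+4) ⟩
        g (q4231 (i ∸ s) + s)      ≡⟨ block (q4231-< x<4) ⟩
        q4231 (q4231 (i ∸ s)) + s  ≡⟨ cong (_+ s) (q4231-involutive x<4) ⟩
        (i ∸ s) + s                ≡⟨ offset s≤i ⟩
        i                          ∎
    }
    where open ≡-Reasoning

  4231-occurrence : Occ231 s (s + 4) g (1 + s , 2 + s , 3 + s)
  4231-occurrence = occ (n≤1+n s) ≤-refl ≤-refl (≤-reflexive (+-comm 4 s))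
    (subst₂ _<_ (sym (block (s≤s (s≤s (s≤s (s≤s z≤n)))))) (sym (block (s≤s (s≤s z≤n)))) (n<1+n s))
    (subst₂ _<_ (sym (block (s≤s (s≤s z≤n)))) (sym (block (s≤s (s≤s (s≤s z≤n))))) (n<1+n (suc s)))

  4231-unique : ∀ {t} → Occ231 s (s + 4) g t → t ≡ (1 + s , 2 + s , 3 + s)
  4231-unique (occ {a} {b} {c} s≤a a<b b<c c<s+4 _ ga<gb) =
    subst (_≡ (1 + s , 2 + s , 3 + s)) (cong₂ _,_ (offset s≤a) (cong₂ _,_ (offset s≤b) (offset s≤c)))
          (cong (λ { (x , y , z) → x + s , y + s , z + s }) offsets)
    where
    s≤b = ≤-trans s≤a (<⇒≤ a<b)
    s≤c = ≤-trans s≤b (<⇒≤ b<c)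
    b<s+4 = <-trans b<c c<s+4
    shift : ∀ {x y} → s ≤ x → s ≤ y → x < y → x ∸ s < y ∸ s
    shift s≤x s≤y x<y = +-cancelʳ-< s _ _ (subst₂ _<_ (sym (offset s≤x)) (sym (offset s≤y)) x<y)
    offsets : (a ∸ s , b ∸ s , c ∸ s) ≡ (1 , 2 , 3)
    offsets with ascent-in-4231 (shift s≤a s≤b a<b) (offset-< s≤b b<s+4)
                   (+-cancelʳ-< s _ _ (subst₂ _<_ (4231-value s≤a (<-trans a<b b<s+4)) (4231-value s≤b b<s+4) ga<gb))
    ... | a′≡1 , b′≡2 = cong₂ _,_ a′≡1 (cong₂ _,_ b′≡2
      (≤-antisym (≤-pred (offset-< s≤c c<s+4)) (subst (_< c ∸ s) b′≡2 (shift s≤b s≤c b<c))))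

size : Block → ℕ
size (rev r) = suc r
size b4231   = 4

totalSize : List Block → ℕ
totalSize bs = sum (map size bs)

blockValue : Block → ℕ → ℕ → ℕ
blockValue (rev r) s i = s + (s + r) ∸ i
blockValue b4231   s i = q4231 (i ∸ s) + s

-- ⟦ bs ⟧ s lays the blocks bs out from s on; it is the identity after them.
⟦_⟧ : List Block → ℕ → ℕ → ℕ
⟦ [] ⟧     s i = i
⟦ b ∷ bs ⟧ s i with i <? s + size b
... | yes _ = blockValue b s i
... | no  _ = ⟦ bs ⟧ (s + size b) i

⟦⟧-head : ∀ b bs {s i} → i < s + size b → ⟦ b ∷ bs ⟧ s i ≡ blockValue b s i
⟦⟧-head b bs {s} {i} i<t with i <? s + size b
... | yes _   = refl
... | no  i≮t = contradiction i<t i≮t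

⟦⟧-tail : ∀ b bs {s i} → s + size b ≤ i → ⟦ b ∷ bs ⟧ s i ≡ ⟦ bs ⟧ (s + size b) i
⟦⟧-tail b bs {s} {i} t≤i with i <? s + size b
... | yes i<t = contradiction t≤i (<⇒≱ i<t)
... | no  _   = refl

blockValue-isBlock : ∀ b s → IsBlock b s (blockValue b s)
blockValue-isBlock (rev r) s _ i≤s+r = m∸n+n≡m (≤-trans i≤s+r (m≤n+m (s + r) s))
blockValue-isBlock b4231   s {x} _ = cong (λ y → q4231 y + s) (m+n∸n≡m x s)

block-involution : ∀ b {s g} → IsBlock b s g → InvolutionOn s (s + size b) g
block-involution (rev r) {s} {g} reversed = subst (λ e → InvolutionOn s e g) (sym (+-suc s r)) (reversal-involution reversed)
block-involution b4231   block        = 4231-involution block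

block-unique : ∀ b {s g h} → IsBlock b s g → IsBlock b s h → AgreeOn s (s + size b) g h
block-unique (rev r) {s} {g} {h} reversed reversed′ {i} s≤i i<t =
  reversal-unique {g = g} reversed {h} reversed′ s≤i (subst (i <_) (+-suc s r) i<t)
block-unique b4231 {g = g} {h} block block′ s≤i i<t =
  trans (4231-value {g = g} block s≤i i<t) (sym (4231-value {g = h} block′ s≤i i<t))

block-end : ∀ b {s g} → IsBlock b s g → suc (g s) ≡ s + size b
block-end (rev r) {s} {g} reversed =
  trans (cong suc (+-cancelʳ-≡ s _ _ (trans (reversed ≤-refl (m≤m+n s r)) (+-comm s (s + r))))) (sym (+-suc s r))
block-end b4231 {s} block = trans (cong suc (block z<s)) (+-comm 4 s)

rev-avoids : ∀ r {s g} → IsBlock (rev r) s g → Avoids231 s (s + size (rev r)) g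
rev-avoids r {s} {g} reversed (occ {c = c} s≤a a<b b<c c<n ga<gc gb<ga) =
  reversal-avoids {g = g} reversed (occ s≤a a<b b<c (subst (c <_) (+-suc s r) c<n) ga<gc gb<ga)

IsBlock-cong : ∀ b {s g h} → AgreeOn s (s + size b) g h → IsBlock b s g → IsBlock b s h
IsBlock-cong (rev r) {s} {g} {h} g≗h reversed {i} s≤i i≤s+r =
  trans (cong (_+ i) (sym (g≗h s≤i (subst (i <_) (sym (+-suc s r)) (s≤s i≤s+r))))) (reversed s≤i i≤s+r)
IsBlock-cong b4231 {s} g≗h block {x} x<4 =
  trans (sym (g≗h (m≤n+m s x) (subst (x + s <_) (+-comm 4 s) (+-monoˡ-< s x<4)))) (block x<4)

reversal-not-4231 : ∀ {s g} → IsReversal s (s + 3) g → ¬ Is4231 s g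
reversal-not-4231 {s} {g} reversed block = 1+n≢n (begin
  suc ((1 + s) + (1 + s))  ≡⟨ lemma s ⟩
  s + (s + 3)              ≡⟨ sym (reversed (n≤1+n s) (≤-trans (≤-reflexive (+-comm 1 s)) (+-monoʳ-≤ s (s≤s z≤n)))) ⟩
  g (1 + s) + (1 + s)      ≡⟨ cong (_+ (1 + s)) (block (s≤s (s≤s z≤n))) ⟩
  (1 + s) + (1 + s)        ∎)
  where
  open ≡-Reasoning
  lemma : ∀ s → suc ((1 + s) + (1 + s)) ≡ s + (s + 3)
  lemma = solve-∀

block-determined : ∀ b b′ {s g} → IsBlock b s g → IsBlock b′ s g → b ≡ b′
block-determined b b′ {s} {g} isBlock isBlock′ =
  same-size b b′ (+-cancelˡ-≡ s _ _ (trans (sym (block-end b isBlock)) (block-end b′ isBlock′))) isBlock isBlock′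
  where
  same-size : ∀ b b′ → size b ≡ size b′ → IsBlock b s g → IsBlock b′ s g → b ≡ b′
  same-size (rev r)  (rev .r)  refl _        _        = refl
  same-size (rev .3) b4231     refl reversed block    = ⊥-elim (reversal-not-4231 reversed block)
  same-size b4231    (rev .3)  refl block    reversed = ⊥-elim (reversal-not-4231 reversed block)
  same-size b4231    b4231     refl _        _        = refl

⟦⟧-injective : ∀ bs bs′ {s} → totalSize bs ≡ totalSize bs′ →
               AgreeOn s (s + totalSize bs) (⟦ bs ⟧ s) (⟦ bs′ ⟧ s) → bs ≡ bs′
⟦⟧-injective []          []          _  _ = refl
⟦⟧-injective []          (rev _ ∷ _) () _
⟦⟧-injective []          (b4231 ∷ _) () _
⟦⟧-injective (rev _ ∷ _) []          () _
⟦⟧-injective (b4231 ∷ _) []          () _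
⟦⟧-injective (b ∷ bs) (b′ ∷ bs′) {s} total agree with block-determined b b′ head head′
  where
  within : ∀ {b″} → size b″ ≤ totalSize (b ∷ bs) → ∀ {i} → i < s + size b″ → i < s + totalSize (b ∷ bs)
  within le i< = <-≤-trans i< (+-monoʳ-≤ s le)
  head : IsBlock b s (⟦ b ∷ bs ⟧ s)
  head = IsBlock-cong b (λ _ i<t → sym (⟦⟧-head b bs i<t)) (blockValue-isBlock b s)
  head′ : IsBlock b′ s (⟦ b ∷ bs ⟧ s)
  head′ = IsBlock-cong b′ (λ s≤i i<t → trans (sym (⟦⟧-head b′ bs′ i<t))
                                            (sym (agree s≤i (within (subst (size b′ ≤_) (sym total) (m≤m+n _ _)) i<t))))
                          (blockValue-isBlock b′ s)
... | refl = cong (b ∷_) (⟦⟧-injective bs bs′ (+-cancelˡ-≡ (size b) _ _ total) λ {i} t≤i i<end →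
  trans (sym (⟦⟧-tail b bs t≤i)) (trans (agree (≤-trans (m≤m+n s (size b)) t≤i)
        (subst (i <_) (+-assoc s (size b) _) i<end)) (⟦⟧-tail b bs′ t≤i)))

-- The first block

module FirstBlock {s n : ℕ} {g : ℕ → ℕ} (inv : InvolutionOn s n g) (s<n : s < n)
                  (atMostOne : AtMostOne231 s n g) where

  private
    v : ℕ
    v = g s

    v<n : v < n
    v<n = upper inv ≤-refl s<n

    g-v : g v ≡ s
    g-v = involutive inv ≤-refl s<n

    inside : ∀ {p} → s < p → p < v → s ≤ p × p < n
    inside s<p p<v = <⇒≤ s<p , <-trans p<v v<n

    involutive′ : ∀ {p} → s < p → p < v → g (g p) ≡ p
    involutive′ s<p p<v = uncurry (involutive inv) (inside s<p p<v)

  interior : ∀ {p} → s < p → p < v → s < g p × g p < v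
  interior {p} s<p p<v = ≤∧≢⇒< (uncurry (lower inv) (inside s<p p<v)) s≢gp , gp<v
    where
    s≢gp : s ≢ g p
    s≢gp s≡gp = <-irrefl (sym (trans (cong g s≡gp) (involutive′ s<p p<v))) p<v

    gp<v : g p < v
    gp<v with <-cmp (g p) v
    ... | tri< lt _ _ = lt
    ... | tri≈ _ gp≡v _ =
      ⊥-elim (<-irrefl (trans (sym g-v) (trans (cong g (sym gp≡v)) (involutive′ s<p p<v))) s<p)
    ... | tri> _ _ v<gp = ⊥-elim (<-irrefl (cong (proj₂ ∘ proj₂) (atMostOne o₁ o₂)) v<gp)
      where
      o₁ : Occ231 s n g (s , p , v)
      o₁ = occ ≤-refl s<p p<v v<n (subst (_< v) (sym g-v) (<-trans s<p p<v)) v<gp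
      o₂ : Occ231 s n g (s , p , g p)
      o₂ = occ ≤-refl s<p (<-trans p<v v<gp) (uncurry (upper inv) (inside s<p p<v))
               (subst (_< v) (sym (involutive′ s<p p<v)) p<v) v<gp

  ascent⇒occ : ∀ {p q} → s < p → p < q → q < v → g p < g q → Occ231 s n g (p , q , v)
  ascent⇒occ s<p p<q q<v = occ (<⇒≤ s<p) p<q q<v v<n
    (subst (_< g _) (sym g-v) (proj₁ (interior s<p (<-trans p<q q<v))))

  descent-unless-ascent : ∀ {p q} → s < p → p < q → q < v → ¬ g p < g q → g q < g p
  descent-unless-ascent {p} {q} s<p p<q q<v ¬ascent with <-cmp (g p) (g q)
  ... | tri< lt _ _ = contradiction lt ¬ascent
  ... | tri≈ _ eq _ = contradiction
    (injective inv (<⇒≤ s<p) (<-trans (<-trans p<q q<v) v<n) (<⇒≤ (<-trans s<p p<q)) (<-trans q<v v<n) eq)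
    (<⇒≢ p<q)
  ... | tri> _ _ gt = gt

  descent-elsewhere : ∀ {i j p q} → s < i → i < j → j < v → g i < g j →
                      s < p → p < q → q < v → p ≢ i ⊎ q ≢ j → g q < g p
  descent-elsewhere s<i i<j j<v ascent s<p p<q q<v ne =
    descent-unless-ascent s<p p<q q<v λ ascent′ →
      let eq = atMostOne (ascent⇒occ s<p p<q q<v ascent′) (ascent⇒occ s<i i<j j<v ascent)
      in [ (λ p≢i → p≢i (cong proj₁ eq)) , (λ q≢j → q≢j (cong (proj₁ ∘ proj₂) eq)) ]′ ne

  ascent-adjacent : ∀ {i j} → s < i → i < j → j < v → g i < g j → j ≡ suc i
  ascent-adjacent {i} {j} s<i i<j j<v ascent with m≤n⇒m<n∨m≡n i<j
  ... | inj₂ 1+i≡j = sym 1+i≡j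
  ... | inj₁ 1+i<j = ⊥-elim (<-asym ascent (<-trans gj<g1+i g1+i<gi))
    where
    s<1+i = <-trans s<i (n<1+n i)
    gj<g1+i = descent-elsewhere s<i i<j j<v ascent s<1+i 1+i<j j<v (inj₁ (<⇒≢ (n<1+n i) ∘ sym))
    g1+i<gi = descent-elsewhere s<i i<j j<v ascent s<i (n<1+n i) (<-trans 1+i<j j<v) (inj₂ (<⇒≢ 1+i<j))

  no-ascent⇒reversal : (∀ {p q} → s < p → p < q → q < v → ¬ g p < g q) → IsReversal s v g
  no-ascent⇒reversal no-ascent {i} s≤i i≤v with m≤n⇒m<n∨m≡n s≤i | m≤n⇒m<n∨m≡n i≤v
  ... | inj₂ refl | _         = +-comm (g s) s
  ... | inj₁ _    | inj₂ refl = cong (_+ v) g-v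
  ... | inj₁ s<i  | inj₁ i<v  = decreasing⇒reflection g interior
    (λ s<p p<q q<v → descent-unless-ascent s<p p<q q<v (no-ascent s<p p<q q<v)) s<i i<v

  -- Composed with the transposition τ of i and i + 1, g is decreasing on (s, v), hence a
  -- reflection there; being an involution, g then fixes i and i + 1, and i = s + 1 by uniqueness.
  module AdjacentAscent {i} (s<i : s < i) (1+i<v : suc i < v) (ascent : g i < g (suc i)) where

    private
      i<v = <-trans (n<1+n i) 1+i<v
      s<1+i = <-trans s<i (n<1+n i)

    τ : ℕ → ℕ
    τ p with p ≟ i | p ≟ suc i
    ... | yes _ | _     = suc i
    ... | no _  | yes _ = i
    ... | no _  | no _  = p

    data SwapView (p : ℕ) : ℕ → Set where
      at-i   : p ≡ i → SwapView p (suc i)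
      at-1+i : p ≡ suc i → SwapView p i
      away   : p ≢ i → p ≢ suc i → SwapView p p

    swap-view : ∀ p → SwapView p (τ p)
    swap-view p with p ≟ i | p ≟ suc i
    ... | yes e  | _      = at-i e
    ... | no _   | yes e  = at-1+i e
    ... | no ne₁ | no ne₂ = away ne₁ ne₂

    τ-into : ∀ {p} → s < p → p < v → s < τ p × τ p < v
    τ-into {p} s<p p<v with τ p | swap-view p
    ... | _ | at-i _   = s<1+i , 1+i<v
    ... | _ | at-1+i _ = s<i , i<v
    ... | _ | away _ _ = s<p , p<v

    private
      other : ∀ {p q} → s < p → p < q → q < v → p ≢ i ⊎ q ≢ suc i → g q < g p
      other = descent-elsewhere s<i (n<1+n i) 1+i<v ascent

    g∘τ-decreasing : ∀ {p q} → s < p → p < q → q < v → g (τ q) < g (τ p)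
    g∘τ-decreasing {p} {q} s<p p<q q<v with τ p | swap-view p | τ q | swap-view q
    ... | _ | at-i refl   | _ | at-i refl   = contradiction p<q (<-irrefl refl)
    ... | _ | at-i refl   | _ | at-1+i refl = ascent
    ... | _ | at-i refl   | _ | away _ q≢1+i =
      other s<1+i (≤∧≢⇒< p<q (q≢1+i ∘ sym)) q<v (inj₁ (<⇒≢ (n<1+n i) ∘ sym))
    ... | _ | at-1+i refl | _ | at-i refl   = contradiction p<q (<-asym (n<1+n i))
    ... | _ | at-1+i refl | _ | at-1+i refl = contradiction p<q (<-irrefl refl)
    ... | _ | at-1+i refl | _ | away _ q≢1+i = other s<i (<-trans (n<1+n i) p<q) q<v (inj₂ q≢1+i)
    ... | _ | away p≢i _  | _ | at-i refl   = other s<p (<-trans p<q (n<1+n i)) 1+i<v (inj₁ p≢i)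
    ... | _ | away p≢i _  | _ | at-1+i refl = other s<p (≤∧≢⇒< (≤-pred p<q) p≢i) i<v (inj₁ p≢i)
    ... | _ | away p≢i _  | _ | away _ _    = other s<p p<q q<v (inj₁ p≢i)

    reflected : ∀ {p} → s < p → p < v → g (τ p) + p ≡ s + v
    reflected = decreasing⇒reflection (g ∘ τ) (λ s<p p<v → uncurry interior (τ-into s<p p<v))
                                      g∘τ-decreasing

    τ-away : ∀ {p} → p ≢ i → p ≢ suc i → τ p ≡ p
    τ-away {p} p≢i p≢1+i with τ p | swap-view p
    ... | _ | at-i e   = contradiction e p≢i
    ... | _ | at-1+i e = contradiction e p≢1+i
    ... | _ | away _ _ = refl

    value-at-i : g (suc i) + i ≡ s + v
    value-at-i with τ i | swap-view i | reflected s<i i<v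
    ... | _ | at-i _   | r = r
    ... | _ | at-1+i e | _ = contradiction e (<⇒≢ (n<1+n i))
    ... | _ | away ne _ | _ = contradiction refl ne

    value-at-1+i : g i + suc i ≡ s + v
    value-at-1+i with τ (suc i) | swap-view (suc i) | reflected s<1+i 1+i<v
    ... | _ | at-1+i _ | r = r
    ... | _ | at-i e   | _ = contradiction (sym e) (<⇒≢ (n<1+n i))
    ... | _ | away _ ne | _ = contradiction refl ne

    fixes-i : g i ≡ i
    fixes-i with τ (g i) | swap-view (g i) | uncurry reflected (interior s<i i<v)
    ... | _ | at-i e   | _ = e
    ... | _ | at-1+i e | _ = contradiction (subst₂ _<_ e g1+i≡i ascent) (<-asym (n<1+n i))
      where
      g1+i≡i : g (suc i) ≡ i
      g1+i≡i = trans (cong g (sym e)) (involutive′ s<i i<v)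
    ... | _ | away _ _ | r = contradiction (+-cancelˡ-≡ (g i) _ _ (begin
      g i + suc i  ≡⟨ value-at-1+i ⟩
      s + v        ≡⟨ sym r ⟩
      g (g i) + g i ≡⟨ cong (_+ g i) (involutive′ s<i i<v) ⟩
      i + g i      ≡⟨ +-comm i (g i) ⟩
      g i + i      ∎)) (<⇒≢ (n<1+n i) ∘ sym)
      where open ≡-Reasoning

    middle : i + suc i ≡ s + v
    middle = trans (cong (_+ suc i) (sym fixes-i)) value-at-1+i

    fixes-1+i : g (suc i) ≡ suc i
    fixes-1+i = +-cancelʳ-≡ i _ _ (trans value-at-i (trans (sym middle) (+-comm i (suc i))))

    i≡1+s : i ≡ suc s
    i≡1+s with m≤n⇒m<n∨m≡n s<i
    ... | inj₂ 1+s≡i = sym 1+s≡i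
    ... | inj₁ 1+s<i = contradiction (cong (proj₂ ∘ proj₂) (atMostOne o (ascent⇒occ s<i ≤-refl 1+i<v ascent)))
                                     (<⇒≢ (proj₂ (interior ≤-refl 1+s<v)))
      where
      1+s<v = <-trans 1+s<i i<v
      c = g (suc s)
      c+1+s : c + suc s ≡ i + suc i
      c+1+s = trans (cong (λ x → g x + suc s) (sym (τ-away (<⇒≢ 1+s<i) (<⇒≢ (<-trans 1+s<i (n<1+n i))))))
                    (trans (reflected ≤-refl 1+s<v) (sym middle))
      1+i<c : suc i < c
      1+i<c = ≰⇒> λ c≤1+i → <-irrefl c+1+s (begin-strict
        c + suc s      ≤⟨ +-monoˡ-≤ (suc s) c≤1+i ⟩
        suc i + suc s  <⟨ +-monoʳ-< (suc i) 1+s<i ⟩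
        suc i + i      ≡⟨ +-comm (suc i) i ⟩
        i + suc i      ∎)
        where open ≤-Reasoning
      o : Occ231 s n g (i , suc i , c)
      o = occ (<⇒≤ s<i) (n<1+n i) 1+i<c (<-trans (proj₂ (interior ≤-refl 1+s<v)) v<n)
              (subst₂ _<_ (sym (involutive′ ≤-refl 1+s<v)) (sym fixes-i) 1+s<i)
              (subst₂ _<_ (sym fixes-i) (sym fixes-1+i) (n<1+n i))

    block : Is4231 s g
    block = is4231 {g = g} v≡3+s
                   (subst (λ x → g x ≡ x) i≡1+s fixes-i)
                   (subst (λ x → g (suc x) ≡ suc x) i≡1+s fixes-1+i)
                   (subst (λ x → g x ≡ s) v≡3+s g-v)
      where
      middle′ : suc s + suc (suc s) ≡ s + v
      middle′ = subst (λ x → x + suc x ≡ s + v) i≡1+s middle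
      v≡3+s : v ≡ 3 + s
      v≡3+s = +-cancelˡ-≡ s _ _ (trans (sym middle′) (sym (+-suc s (2 + s))))

  private
    reversal : (∀ {p q} → s < p → p < q → q < v → ¬ g p < g q) → Σ Block λ b → IsBlock b s g
    reversal no-ascent = rev (v ∸ s) ,
      subst (λ e → IsReversal s e g) (sym (m+[n∸m]≡n (lower inv ≤-refl s<n))) (no-ascent⇒reversal no-ascent)

    from-occurrence : ∀ {t} → Occ231 s n g t → Σ Block λ b → IsBlock b s g
    from-occurrence o@(occ {a} {b} {c} _ a<b b<c _ _ ga<gb) with c ≟ v | s <? a
    ... | no c≢v | _ = reversal λ s<p p<q q<v ascent →
      c≢v (sym (cong (proj₂ ∘ proj₂) (atMostOne (ascent⇒occ s<p p<q q<v ascent) o)))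
    ... | yes _ | no s≮a = reversal λ s<p p<q q<v ascent →
      s≮a (subst (s <_) (cong proj₁ (atMostOne (ascent⇒occ s<p p<q q<v ascent) o)) s<p)
    ... | yes refl | yes s<a with ascent-adjacent s<a a<b b<c ga<gb
    ...   | refl = b4231 , AdjacentAscent.block s<a b<c ga<gb

  -- Knowing the occurrence (a , b , c), if any, decides whether (s, v) has an ascent:
  -- it has one iff c = v and s < a.
  first-block : Avoids231 s n g ⊎ ∃ (Occ231 s n g) → Σ Block λ b → IsBlock b s g
  first-block (inj₁ avoids) = reversal λ s<p p<q q<v ascent → avoids (ascent⇒occ s<p p<q q<v ascent)
  first-block (inj₂ (_ , o)) = from-occurrence o

-- Decomposition into blocks

module _ (b : Block) (bs : List Block) (s : ℕ) where

  private
    t = s + size b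
    n = s + totalSize (b ∷ bs)

    n≡ : t + totalSize bs ≡ n
    n≡ = +-assoc s (size b) (totalSize bs)

    s≤t : s ≤ t
    s≤t = m≤m+n s (size b)

    t≤n : t ≤ n
    t≤n = subst (t ≤_) n≡ (m≤m+n t _)

    head-agrees : AgreeOn s t (⟦ b ∷ bs ⟧ s) (blockValue b s)
    head-agrees _ i<t = ⟦⟧-head b bs i<t

    tail-agrees : AgreeOn t n (⟦ b ∷ bs ⟧ s) (⟦ bs ⟧ t)
    tail-agrees t≤i _ = ⟦⟧-tail b bs t≤i

    head-involution : InvolutionOn s t (⟦ b ∷ bs ⟧ s)
    head-involution = InvolutionOn-cong (λ s≤i i<t → sym (head-agrees s≤i i<t))
                                        (block-involution b (blockValue-isBlock b s))

  cons-involution : InvolutionOn t (t + totalSize bs) (⟦ bs ⟧ t) → InvolutionOn s n (⟦ b ∷ bs ⟧ s)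
  cons-involution rest = involution-glue s≤t t≤n head-involution
    (InvolutionOn-cong (λ t≤i i<n → sym (tail-agrees t≤i i<n))
                       (subst (λ e → InvolutionOn t e (⟦ bs ⟧ t)) n≡ rest))

  cons-occ-split : InvolutionOn t (t + totalSize bs) (⟦ bs ⟧ t) → ∀ {u} → Occ231 s n (⟦ b ∷ bs ⟧ s) u →
                   Occ231 s t (blockValue b s) u ⊎ Occ231 t (t + totalSize bs) (⟦ bs ⟧ t) u
  cons-occ-split rest {u} o = ⊎.map (Occ231-cong head-agrees)
    (subst (λ e → Occ231 t e (⟦ bs ⟧ t) u) (sym n≡) ∘ Occ231-cong tail-agrees)
    (Occ231-split s≤t (upper head-involution) (cons-involution rest) o)

  cons-occ-head : ∀ {u} → Occ231 s t (blockValue b s) u → Occ231 s n (⟦ b ∷ bs ⟧ s) u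
  cons-occ-head o = Occ231-widen ≤-refl t≤n (Occ231-cong (λ s≤i i<t → sym (head-agrees s≤i i<t)) o)

  cons-occ-tail : ∀ {u} → Occ231 t (t + totalSize bs) (⟦ bs ⟧ t) u → Occ231 s n (⟦ b ∷ bs ⟧ s) u
  cons-occ-tail {u} o = Occ231-widen s≤t ≤-refl
    (Occ231-cong (λ t≤i i<n → sym (tail-agrees t≤i i<n)) (subst (λ e → Occ231 t e (⟦ bs ⟧ t) u) n≡ o))

shape : List ℕ × List ℕ → List Block
shape (l₁ , l₂) = map rev l₁ ++ b4231 ∷ map rev l₂

private
  empty-interval : ∀ {s i} → s ≤ i → i < s + 0 → ⊥
  empty-interval {s} s≤i i<s+0 = <-irrefl (sym (+-identityʳ s)) (≤-<-trans s≤i i<s+0)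

⟦revs⟧-avoids231 : ∀ l s → InvolutionOn s (s + totalSize (map rev l)) (⟦ map rev l ⟧ s)
                         × Avoids231 s (s + totalSize (map rev l)) (⟦ map rev l ⟧ s)
⟦revs⟧-avoids231 [] s =
  record { lower = λ s≤i i<s → ⊥-elim (empty-interval s≤i i<s)
         ; upper = λ s≤i i<s → ⊥-elim (empty-interval s≤i i<s)
         ; involutive = λ s≤i i<s → ⊥-elim (empty-interval s≤i i<s) } ,
  λ o → empty-interval ≤-refl (occ-start<end o)
⟦revs⟧-avoids231 (r ∷ l) s with ⟦revs⟧-avoids231 l (s + suc r)
... | inv , avoids = cons-involution (rev r) (map rev l) s inv ,
  λ o → [ rev-avoids r (blockValue-isBlock (rev r) s) , avoids ]′ (cons-occ-split (rev r) (map rev l) s inv o)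

⟦shape⟧-unique231 : ∀ l₁ l₂ s → let bs = shape (l₁ , l₂) in
                 InvolutionOn s (s + totalSize bs) (⟦ bs ⟧ s) × Unique231 s (s + totalSize bs) (⟦ bs ⟧ s)
⟦shape⟧-unique231 [] l₂ s with ⟦revs⟧-avoids231 l₂ (s + 4)
... | inv , avoids = cons-involution b4231 (map rev l₂) s inv ,
  (1 + s , 2 + s , 3 + s) , cons-occ-head b4231 (map rev l₂) s (4231-occurrence block) ,
  λ o → [ (λ o′ → sym (4231-unique block o′)) , (λ o′ → ⊥-elim (avoids o′)) ]′
          (cons-occ-split b4231 (map rev l₂) s inv o)
  where
  block = blockValue-isBlock b4231 s
⟦shape⟧-unique231 (r ∷ l₁) l₂ s with ⟦shape⟧-unique231 l₁ l₂ (s + suc r)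
... | inv , t₀ , o₀ , unique = cons-involution (rev r) bs s inv , t₀ , cons-occ-tail (rev r) bs s o₀ ,
  λ o → [ (λ o′ → ⊥-elim (rev-avoids r (blockValue-isBlock (rev r) s) o′)) , unique ]′
          (cons-occ-split (rev r) bs s inv o)
  where
  bs = shape (l₁ , l₂)

module Decomposition {n : ℕ} {g : ℕ → ℕ} where

  private
    module Step {s} (inv : InvolutionOn s n g) (s<n : s < n) (b : Block) (isBlock : IsBlock b s g) where
      t = s + size b

      s<t : s < t
      s<t = subst (s <_) (block-end b isBlock) (s≤s (lower inv ≤-refl s<n))

      t≤n : t ≤ n
      t≤n = subst (_≤ n) (block-end b isBlock) (upper inv ≤-refl s<n)

      closed : ∀ {i} → s ≤ i → i < t → g i < t
      closed = upper (block-involution b isBlock)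

      rest : InvolutionOn t n g
      rest = involution-rest (<⇒≤ s<t) closed inv

      shrinks : n ∸ t < n ∸ s
      shrinks = ∸-monoʳ-< s<t t≤n

      narrow : ∀ {u} → Occ231 t n g u → Occ231 s n g u
      narrow = Occ231-widen (<⇒≤ s<t) ≤-refl

      extend : ∀ {bs} → t + totalSize bs ≡ n → AgreeOn t n g (⟦ bs ⟧ t) →
               s + totalSize (b ∷ bs) ≡ n × AgreeOn s n g (⟦ b ∷ bs ⟧ s)
      extend {bs} total agrees = trans (sym (+-assoc s (size b) _)) total ,
        AgreeOn-glue (λ s≤i i<t → trans (block-unique b isBlock (blockValue-isBlock b s) s≤i i<t)
                                        (sym (⟦⟧-head b bs i<t)))
                     (λ t≤i i<n → trans (agrees t≤i i<n) (sym (⟦⟧-tail b bs t≤i)))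

  decompose-avoiding : ∀ {s} → Acc _<_ (n ∸ s) → s ≤ n → InvolutionOn s n g → Avoids231 s n g →
                       ∃[ l ] s + totalSize (map rev l) ≡ n × AgreeOn s n g (⟦ map rev l ⟧ s)
  decompose-avoiding {s} (acc rs) s≤n inv avoids with m≤n⇒m<n∨m≡n s≤n
  ... | inj₂ refl = [] , +-identityʳ s , λ s≤i i<s → contradiction i<s (≤⇒≯ s≤i)
  ... | inj₁ s<n with FirstBlock.first-block inv s<n (λ o → contradiction o avoids) (inj₁ avoids)
  ...   | b4231 , block = contradiction (Occ231-widen ≤-refl t≤n (4231-occurrence block)) avoids
    where open Step inv s<n b4231 block
  ...   | rev r , reversed = let (l , total , agrees) = rec in r ∷ l , extend total agrees
    where
    open Step inv s<n (rev r) reversed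
    rec = decompose-avoiding (rs shrinks) t≤n rest (avoids ∘ narrow)

  decompose-unique : ∀ {s} → Acc _<_ (n ∸ s) → InvolutionOn s n g → Unique231 s n g →
                     ∃[ st ] s + totalSize (shape st) ≡ n × AgreeOn s n g (⟦ shape st ⟧ s)
  decompose-unique {s} (acc rs) inv (t₀ , o₀ , unique)
    with FirstBlock.first-block inv (occ-start<end o₀) (λ o o′ → trans (sym (unique o)) (unique o′))
                                (inj₂ (t₀ , o₀))
  ... | b4231 , block = let (l₂ , total , agrees) = rec in ([] , l₂) , extend total agrees
    where
    open Step inv (occ-start<end o₀) b4231 block
    t₀≡ : t₀ ≡ (1 + s , 2 + s , 3 + s)
    t₀≡ = unique (Occ231-widen ≤-refl t≤n (4231-occurrence block))
    rest-avoids : Avoids231 t n g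
    rest-avoids o = <⇒≱ (subst (1 + s <_) (+-comm 4 s) (+-monoˡ-< s (s≤s (s≤s z≤n))))
      (subst (t ≤_) (cong proj₁ (trans (sym (unique (narrow o))) t₀≡)) (occ-start o))
    rec = decompose-avoiding (rs shrinks) t≤n rest rest-avoids
  ... | rev r , reversed = let ((l₁ , l₂) , total , agrees) = rec in (r ∷ l₁ , l₂) , extend total agrees
    where
    open Step inv (occ-start<end o₀) (rev r) reversed
    rest-unique : Unique231 t n g
    rest-unique with Occ231-split (<⇒≤ s<t) closed inv o₀
    ... | inj₁ o-in  = contradiction o-in (rev-avoids r reversed)
    ... | inj₂ o-out = t₀ , o-out , unique ∘ narrow
    rec = decompose-unique (rs shrinks) rest rest-unique

shape-injective : ∀ {l₁ l₂ l₁′ l₂′} → shape (l₁ , l₂) ≡ shape (l₁′ , l₂′) → (l₁ , l₂) ≡ (l₁′ , l₂′)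
shape-injective {[]}    {_} {[]}    eq = cong ([] ,_) (List.map-injective (λ { refl → refl }) (List.∷-injectiveʳ eq))
shape-injective {[]}    {_} {_ ∷ _} ()
shape-injective {_ ∷ _} {_} {[]}    ()
shape-injective {r ∷ _} {_} {_ ∷ _} eq with List.∷-injective eq
... | refl , rest = cong (λ { (l₁ , l₂) → r ∷ l₁ , l₂ }) (shape-injective rest)

-- Fixed points

fixedCount : ℕ → ℕ → (ℕ → ℕ) → ℕ
fixedCount s zero    g = 0
fixedCount s (suc m) g = (if ⌊ g s ≟ s ⌋ then 1 else 0) + fixedCount (suc s) m g

module _ {s : ℕ} (m : ℕ) (g : ℕ → ℕ) where

  fixedCount-fixed : g s ≡ s → fixedCount s (suc m) g ≡ suc (fixedCount (suc s) m g)
  fixedCount-fixed gs≡s with g s ≟ s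
  ... | yes _    = refl
  ... | no gs≢s = contradiction gs≡s gs≢s

  fixedCount-moved : g s ≢ s → fixedCount s (suc m) g ≡ fixedCount (suc s) m g
  fixedCount-moved gs≢s with g s ≟ s
  ... | yes gs≡s = contradiction gs≡s gs≢s
  ... | no _     = refl

fixedCount-cong : ∀ s m {g h} → AgreeOn s (s + m) g h → fixedCount s m g ≡ fixedCount s m h
fixedCount-cong s zero    g≗h = refl
fixedCount-cong s (suc m) g≗h =
  cong₂ _+_ (cong (λ x → if ⌊ x ≟ s ⌋ then 1 else 0) (g≗h ≤-refl (m<m+n s z<s)))
            (fixedCount-cong (suc s) m λ {i} 1+s≤i i<1+s+m →
               g≗h (<⇒≤ 1+s≤i) (subst (i <_) (sym (+-suc s m)) i<1+s+m))

fixedCount-+ : ∀ s m₁ m₂ g → fixedCount s (m₁ + m₂) g ≡ fixedCount s m₁ g + fixedCount (s + m₁) m₂ g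
fixedCount-+ s zero      m₂ g = cong (λ x → fixedCount x m₂ g) (sym (+-identityʳ s))
fixedCount-+ s (suc m₁) m₂ g = begin
  f + fixedCount (suc s) (m₁ + m₂) g
    ≡⟨ cong (f +_) (fixedCount-+ (suc s) m₁ m₂ g) ⟩
  f + (fixedCount (suc s) m₁ g + fixedCount (suc s + m₁) m₂ g)
    ≡⟨ sym (+-assoc f _ _) ⟩
  f + fixedCount (suc s) m₁ g + fixedCount (suc s + m₁) m₂ g
    ≡⟨ cong (λ x → f + fixedCount (suc s) m₁ g + fixedCount x m₂ g) (sym (+-suc s m₁)) ⟩
  f + fixedCount (suc s) m₁ g + fixedCount (s + suc m₁) m₂ g
    ∎
  where
  open ≡-Reasoning
  f = if ⌊ g s ≟ s ⌋ then 1 else 0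

module _ {s v : ℕ} {g : ℕ → ℕ} (reversed : IsReversal s v g) where

  reversal-moves-start : s < v → g s ≢ s
  reversal-moves-start s<v gs≡s =
    <⇒≢ s<v (+-cancelˡ-≡ s _ _ (trans (cong (_+ s) (sym gs≡s)) (reversed ≤-refl (<⇒≤ s<v))))

  reversal-moves-end : s < v → g v ≢ v
  reversal-moves-end s<v gv≡v =
    <⇒≢ s<v (sym (+-cancelʳ-≡ v _ _ (trans (cong (_+ v) (sym gv≡v)) (reversed (<⇒≤ s<v) ≤-refl))))

reversal-inner : ∀ {s v g} → IsReversal s (suc v) g → IsReversal (suc s) v g
reversal-inner {s} {v} reversed 1+s≤i i≤v = trans (reversed (<⇒≤ 1+s≤i) (m≤n⇒m≤1+n i≤v)) (+-suc s v)

revPairs : ℕ → ℕ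
revPairs 0             = 0
revPairs 1             = 1
revPairs (suc (suc r)) = suc (revPairs r)

revFixed : ℕ → ℕ
revFixed 0             = 1
revFixed 1             = 0
revFixed (suc (suc r)) = revFixed r

rev-size : ∀ r → suc r ≡ 2 * revPairs r + revFixed r
rev-size 0             = refl
rev-size 1             = refl
rev-size (suc (suc r)) = trans (cong (2 +_) (rev-size r)) (lemma (revPairs r) (revFixed r))
  where
  lemma : ∀ p f → 2 + (2 * p + f) ≡ 2 * suc p + f
  lemma = solve-∀

fixedCount-reversal : ∀ r {s g} → IsReversal s (s + r) g → fixedCount s (suc r) g ≡ revFixed r
fixedCount-reversal 0 {s} {g} reversed =
  fixedCount-fixed 0 g (+-cancelʳ-≡ s _ _ (trans (reversed ≤-refl (m≤m+n s 0)) (cong (s +_) (+-identityʳ s))))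
fixedCount-reversal 1 {s} {g} reversed = trans (fixedCount-moved 1 g (reversal-moves-start reversed s<1+s))
  (fixedCount-moved 0 g (subst (λ x → g x ≢ x) (+-comm s 1) (reversal-moves-end reversed s<1+s)))
  where
  s<1+s = m<m+n s z<s
fixedCount-reversal (suc (suc r)) {s} {g} reversed = begin
  fixedCount s (3 + r) g                                   ≡⟨ fixedCount-moved (2 + r) g (reversal-moves-start reversed′ s<v) ⟩
  fixedCount (suc s) (2 + r) g                             ≡⟨ cong (λ m → fixedCount (suc s) m g) (+-comm 1 (suc r)) ⟩
  fixedCount (suc s) (suc r + 1) g                         ≡⟨ fixedCount-+ (suc s) (suc r) 1 g ⟩
  fixedCount (suc s) (suc r) g + fixedCount (suc s + suc r) 1 g
    ≡⟨ cong₂ _+_ (fixedCount-reversal r (reversal-inner reversed′)) (fixedCount-moved 0 g end-moved) ⟩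
  revFixed r + 0                                           ≡⟨ +-identityʳ (revFixed r) ⟩
  revFixed r                                               ∎
  where
  open ≡-Reasoning
  v = 2 + (s + r)
  v≡ : s + (2 + r) ≡ v
  v≡ = trans (+-suc s (suc r)) (cong suc (+-suc s r))
  reversed′ : IsReversal s v g
  reversed′ = subst (λ e → IsReversal s e g) v≡ reversed
  s<v : s < v
  s<v = s≤s (m≤n⇒m≤1+n (m≤m+n s r))
  end-moved : g (suc s + suc r) ≢ suc s + suc r
  end-moved = subst (λ x → g x ≢ x) (cong suc (sym (+-suc s r))) (reversal-moves-end reversed′ s<v)

fixedCount-4231 : ∀ {s g} → Is4231 s g → fixedCount s 4 g ≡ 2
fixedCount-4231 {s} {g} block = begin
  fixedCount s 4 g              ≡⟨ fixedCount-moved 3 g (λ e → <⇒≢ (m<n+m s z<s) (trans (sym e) (block z<s))) ⟩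
  fixedCount (1 + s) 3 g        ≡⟨ fixedCount-fixed 2 g (block (s≤s (s≤s z≤n))) ⟩
  suc (fixedCount (2 + s) 2 g)  ≡⟨ cong suc (fixedCount-fixed 1 g (block (s≤s (s≤s (s≤s z≤n))))) ⟩
  2 + fixedCount (3 + s) 1 g    ≡⟨ cong (2 +_) (fixedCount-moved 0 g (λ e → <⇒≢ (m<n+m s z<s) (trans (sym (block 3<4)) e))) ⟩
  2                             ∎
  where
  open ≡-Reasoning
  3<4 : 3 < 4
  3<4 = ≤-refl

blockFixed : Block → ℕ
blockFixed (rev r) = revFixed r
blockFixed b4231   = 2

fixedCount-block : ∀ b {s g} → IsBlock b s g → fixedCount s (size b) g ≡ blockFixed b
fixedCount-block (rev r)         = fixedCount-reversal r
fixedCount-block b4231 {s} {g} = fixedCount-4231 {s} {g}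

fixedCount-⟦⟧ : ∀ bs s → fixedCount s (totalSize bs) (⟦ bs ⟧ s) ≡ sum (map blockFixed bs)
fixedCount-⟦⟧ []       s = refl
fixedCount-⟦⟧ (b ∷ bs) s = begin
  fixedCount s (size b + totalSize bs) (⟦ b ∷ bs ⟧ s)
    ≡⟨ fixedCount-+ s (size b) (totalSize bs) _ ⟩
  fixedCount s (size b) (⟦ b ∷ bs ⟧ s) + fixedCount (s + size b) (totalSize bs) (⟦ b ∷ bs ⟧ s)
    ≡⟨ cong₂ _+_ (fixedCount-cong s (size b) (λ _ i<t → ⟦⟧-head b bs i<t))
                 (fixedCount-cong (s + size b) (totalSize bs) (λ t≤i _ → ⟦⟧-tail b bs t≤i)) ⟩
  fixedCount s (size b) (blockValue b s) + fixedCount (s + size b) (totalSize bs) (⟦ bs ⟧ (s + size b))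
    ≡⟨ cong₂ _+_ (fixedCount-block b (blockValue-isBlock b s)) (fixedCount-⟦⟧ bs (s + size b)) ⟩
  blockFixed b + sum (map blockFixed bs)
    ∎
  where open ≡-Reasoning

length-unique-≡ : ∀ {A : Set} {xs ys : List A} → Unique xs → Unique ys → (∀ {x} → x ∈ xs ⇔ x ∈ ys) →
                  length xs ≡ length ys
length-unique-≡ unique-xs unique-ys same = ↭-length (∼bag⇒↭ (unique∧set⇒bag unique-xs unique-ys same))

length-filterᵇ : ∀ {A : Set} (p : A → Bool) {xs ys : List A} → Unique xs → Unique ys →
                 (∀ {y} → y ∈ ys → y ∈ xs × T (p y)) → (∀ {x} → x ∈ xs → T (p x) → x ∈ ys) →
                 length (filterᵇ p xs) ≡ length ys
length-filterᵇ p {xs} unique-xs unique-ys sound complete =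
  length-unique-≡ (Unique.filter⁺ (T? ∘ p) unique-xs) unique-ys (mk⇔
    (λ x∈ → uncurry complete (∈-filter⁻ (T? ∘ p) {xs = xs} x∈))
    (λ y∈ → uncurry (∈-filter⁺ (T? ∘ p)) (sound y∈)))

module _ {A : Set} {xs : List A} (unique : Unique xs) (complete : ∀ x → x ∈ xs) (p : A → Bool) where

  length-filterᵇ≡1⇔ : length (filterᵇ p xs) ≡ 1 ⇔ ∃! _≡_ (T ∘ p)
  length-filterᵇ≡1⇔ = mk⇔ to from
    where
    to : length (filterᵇ p xs) ≡ 1 → ∃! _≡_ (T ∘ p)
    to eq with filterᵇ p xs in filter≡ | eq
    ... | v ∷ [] | refl = v , proj₂ (∈-filter⁻ (T? ∘ p) {xs = xs} (subst (v ∈_) (sym filter≡) (here refl))) ,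
      λ {w} pw → singleton (subst (w ∈_) filter≡ (∈-filter⁺ (T? ∘ p) (complete w) pw))
      where
      singleton : ∀ {w} → w ∈ v ∷ [] → v ≡ w
      singleton (here w≡v) = sym w≡v
    from : ∃! _≡_ (T ∘ p) → length (filterᵇ p xs) ≡ 1
    from (v , pv , only) = length-filterᵇ p unique ([] ∷ [])
      (λ { (here refl) → complete v , pv }) (λ x∈ px → here (sym (only px)))

∃!-bijection : ∀ {A B : Set} {P : A → Set} {Q : B → Set} (f : A → B) →
               (∀ {x} → P x → Q (f x)) → (∀ {y} → Q y → ∃[ x ] P x × f x ≡ y) →
               (∀ {x x′} → P x → P x′ → f x ≡ f x′ → x ≡ x′) → ∃! _≡_ P ⇔ ∃! _≡_ Q
∃!-bijection {P = P} {Q} f preserves onto injective = mk⇔ to from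
  where
  to : ∃! _≡_ P → ∃! _≡_ Q
  to (x , px , only) = f x , preserves px , λ qy →
    let (x′ , px′ , fx′≡y) = onto qy in trans (cong f (only px′)) fx′≡y
  from : ∃! _≡_ Q → ∃! _≡_ P
  from (y , qy , only) = let (x , px , fx≡y) = onto qy in
    x , px , λ px′ → injective px px′ (trans fx≡y (only (preserves px′)))

length-≡-0 : ∀ {A : Set} {xs : List A} → (∀ {x} → x ∈ xs → ⊥) → length xs ≡ 0
length-≡-0 {xs = []}    _     = refl
length-≡-0 {xs = x ∷ _} empty = ⊥-elim (empty (here refl))

Unique-map-on : ∀ {A B : Set} {P : A → Set} (f : A → B) {xs : List A} → (∀ {x} → x ∈ xs → P x) →
                (∀ {x y} → P x → P y → f x ≡ f y → x ≡ y) → Unique xs → Unique (map f xs)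
Unique-map-on f {[]}     _    _         []              = []
Unique-map-on f {x ∷ xs} in-P injective (x∉xs ∷ unique) =
  All.tabulate (λ {y} y∈ → let (z , z∈ , y≡fz) = ∈-map⁻ f y∈ in
    λ fx≡y → All.lookup x∉xs z∈ (injective (in-P (here refl)) (in-P (there z∈)) (trans fx≡y y≡fz))) ∷
  Unique-map-on f (in-P ∘ there) injective unique

-- Enumerating block sequences

-- withPrefixes p q lists the pairs (l , a) of a list l of reversal blocks and a tail
-- a ∈ tails p′ q′ whose totals of 2-cycles and fixed points are p and q. The entries with a
-- first block r ≥ 2 are obtained from those with first block r ∸ 2 by bump, which keeps all
-- recurrences finite.
module Prefixed {A : Set} (tails : ℕ → ℕ → List A) (tailPairs tailFixed : A → ℕ) where

  pairs : List ℕ × A → ℕ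
  pairs ([] , a)    = tailPairs a
  pairs (r ∷ l , a) = revPairs r + pairs (l , a)

  fixed : List ℕ × A → ℕ
  fixed ([] , a)    = tailFixed a
  fixed (r ∷ l , a) = revFixed r + fixed (l , a)

  private
    start : A → List ℕ × A
    start a = [] , a

    put : ℕ → List ℕ × A → ℕ × List ℕ × A
    put r x = r , x

    bump : ℕ × List ℕ × A → ℕ × List ℕ × A
    bump (r , x) = suc (suc r) , x

    unfold : ℕ × List ℕ × A → List ℕ × A
    unfold (r , l , a) = r ∷ l , a

  mutual
    withPrefixes : ℕ → ℕ → List (List ℕ × A)
    withPrefixes p q = map start (tails p q) ++ map unfold (headed p q)

    headed : ℕ → ℕ → List (ℕ × List ℕ × A)
    headed p q = fixedHead p q ++ pairHead p q

    fixedHead : ℕ → ℕ → List (ℕ × List ℕ × A)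
    fixedHead p zero    = []
    fixedHead p (suc q) = map (put 0) (withPrefixes p q)

    pairHead : ℕ → ℕ → List (ℕ × List ℕ × A)
    pairHead zero    q = []
    pairHead (suc p) q = map (put 1) (withPrefixes p q) ++ map bump (headed p q)

  module _ (tails-sound : ∀ {p q a} → a ∈ tails p q → tailPairs a ≡ p × tailFixed a ≡ q) where

    mutual
      withPrefixes-sound : ∀ {p q x} → x ∈ withPrefixes p q → pairs x ≡ p × fixed x ≡ q
      withPrefixes-sound {p} {q} x∈ with ∈-++⁻ (map start (tails p q)) x∈
      ... | inj₁ x∈tails with ∈-map⁻ start x∈tails
      ...   | _ , a∈ , refl = tails-sound a∈
      withPrefixes-sound {p} {q} x∈ | inj₂ x∈headed with ∈-map⁻ unfold x∈headed
      ...   | _ , y∈ , refl = headed-sound y∈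

      headed-sound : ∀ {p q r l a} → (r , l , a) ∈ headed p q →
                     revPairs r + pairs (l , a) ≡ p × revFixed r + fixed (l , a) ≡ q
      headed-sound {p} {q} y∈ with ∈-++⁻ (fixedHead p q) y∈
      ... | inj₁ y∈fixed = fixedHead-sound y∈fixed
      ... | inj₂ y∈pair  = pairHead-sound y∈pair

      fixedHead-sound : ∀ {p q r l a} → (r , l , a) ∈ fixedHead p q →
                        revPairs r + pairs (l , a) ≡ p × revFixed r + fixed (l , a) ≡ q
      fixedHead-sound {q = suc q} y∈ with ∈-map⁻ (put 0) y∈
      ... | _ , x∈ , refl = let (p≡ , q≡) = withPrefixes-sound x∈ in p≡ , cong suc q≡

      pairHead-sound : ∀ {p q r l a} → (r , l , a) ∈ pairHead p q →
                       revPairs r + pairs (l , a) ≡ p × revFixed r + fixed (l , a) ≡ q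
      pairHead-sound {suc p} {q} y∈ with ∈-++⁻ (map (put 1) (withPrefixes p q)) y∈
      ... | inj₁ y∈one with ∈-map⁻ (put 1) y∈one
      ...   | _ , x∈ , refl = let (p≡ , q≡) = withPrefixes-sound x∈ in cong suc p≡ , q≡
      pairHead-sound {suc p} {q} y∈ | inj₂ y∈bump with ∈-map⁻ bump y∈bump
      ...   | _ , z∈ , refl = let (p≡ , q≡) = headed-sound z∈ in cong suc p≡ , q≡

  module _ (tails-complete : ∀ a → a ∈ tails (tailPairs a) (tailFixed a)) where

    mutual
      withPrefixes-complete : ∀ l a → (l , a) ∈ withPrefixes (pairs (l , a)) (fixed (l , a))
      withPrefixes-complete []      a = ∈-++⁺ˡ (∈-map⁺ start (tails-complete a))
      withPrefixes-complete (r ∷ l) a = ∈-++⁺ʳ (map start (tails _ _)) (∈-map⁺ unfold (headed-complete r l a))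

      headed-complete : ∀ r l a → (r , l , a) ∈ headed (revPairs r + pairs (l , a)) (revFixed r + fixed (l , a))
      headed-complete 0             l a = ∈-++⁺ˡ (∈-map⁺ (put 0) (withPrefixes-complete l a))
      headed-complete 1             l a =
        ∈-++⁺ʳ (fixedHead (suc (pairs (l , a))) (fixed (l , a))) (∈-++⁺ˡ (∈-map⁺ (put 1) (withPrefixes-complete l a)))
      headed-complete (suc (suc r)) l a =
        ∈-++⁺ʳ (fixedHead (suc p) q) (∈-++⁺ʳ (map (put 1) (withPrefixes p q)) (∈-map⁺ bump (headed-complete r l a)))
        where
        p = revPairs r + pairs (l , a)
        q = revFixed r + fixed (l , a)

  private
    head-of-map : ∀ {k : ℕ} {y} {zs : List (List ℕ × A)} → y ∈ map (put k) zs → proj₁ y ≡ k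
    head-of-map {k} y∈ with ∈-map⁻ (put k) y∈
    ... | _ , _ , refl = refl

    head-of-bump : ∀ {y zs} → y ∈ map bump zs → 2 ≤ proj₁ y
    head-of-bump y∈ with ∈-map⁻ bump y∈
    ... | _ , _ , refl = s≤s (s≤s z≤n)

    head-of-fixedHead : ∀ {p q y} → y ∈ fixedHead p q → proj₁ y ≡ 0
    head-of-fixedHead {p} {suc q} y∈ = head-of-map {zs = withPrefixes p q} y∈

    head-of-pairHead : ∀ {p q y} → y ∈ pairHead p q → 1 ≤ proj₁ y
    head-of-pairHead {suc p} {q} y∈ with ∈-++⁻ (map (put 1) (withPrefixes p q)) y∈
    ... | inj₁ y∈one  = ≤-reflexive (sym (head-of-map {zs = withPrefixes p q} y∈one))
    ... | inj₂ y∈bump = ≤-trans (s≤s z≤n) (head-of-bump {zs = headed p q} y∈bump)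

    unfold-injective : ∀ {x y} → unfold x ≡ unfold y → x ≡ y
    unfold-injective {_ , _ , _} {_ , _ , _} refl = refl

    bump-injective : ∀ {x y} → bump x ≡ bump y → x ≡ y
    bump-injective {_ , _} {_ , _} refl = refl

  module _ (tails-unique : ∀ p q → Unique (tails p q)) where

    mutual
      withPrefixes-unique : ∀ p q → Unique (withPrefixes p q)
      withPrefixes-unique p q =
        Unique.++⁺ (Unique.map⁺ (cong proj₂) (tails-unique p q)) (Unique.map⁺ unfold-injective (headed-unique p q))
          λ (x∈₁ , x∈₂) →
            []≢unfold (proj₂ (proj₂ (∈-map⁻ _ x∈₁))) (proj₂ (proj₂ (∈-map⁻ unfold x∈₂)))
        where
        []≢unfold : ∀ {x a y} → x ≡ ([] , a) → x ≡ unfold y → ⊥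
        []≢unfold {y = _ , _ , _} refl ()

      headed-unique : ∀ p q → Unique (headed p q)
      headed-unique p q = Unique.++⁺ (fixedHead-unique p q) (pairHead-unique p q)
        λ (y∈₁ , y∈₂) →
          contradiction (subst (1 ≤_) (head-of-fixedHead {p} {q} y∈₁) (head-of-pairHead {p} {q} y∈₂)) λ ()

      fixedHead-unique : ∀ p q → Unique (fixedHead p q)
      fixedHead-unique p zero    = []
      fixedHead-unique p (suc q) = Unique.map⁺ (cong proj₂) (withPrefixes-unique p q)

      pairHead-unique : ∀ p q → Unique (pairHead p q)
      pairHead-unique zero    q = []
      pairHead-unique (suc p) q =
        Unique.++⁺ (Unique.map⁺ (cong proj₂) (withPrefixes-unique p q)) (Unique.map⁺ bump-injective (headed-unique p q))
          λ (y∈₁ , y∈₂) → contradiction (subst (2 ≤_) (head-of-map {zs = withPrefixes p q} y∈₁)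
                                                          (head-of-bump {zs = headed p q} y∈₂)) λ { (s≤s ()) }

  count : ℕ → ℕ → ℕ
  count p q = length (withPrefixes p q)

  headCount : ℕ → ℕ → ℕ
  headCount p q = length (headed p q)

  count-≡ : ∀ p q → count p q ≡ length (tails p q) + headCount p q
  count-≡ p q = trans (length-++ (map start (tails p q)))
                      (cong₂ _+_ (length-map start (tails p q)) (length-map unfold (headed p q)))

  private
    pairHead-length : ∀ p q → length (pairHead (suc p) q) ≡ count p q + headCount p q
    pairHead-length p q = trans (length-++ (map (put 1) (withPrefixes p q)))
                                (cong₂ _+_ (length-map (put 1) (withPrefixes p q)) (length-map bump (headed p q)))

  headCount-0-suc : ∀ q → headCount 0 (suc q) ≡ count 0 q
  headCount-0-suc q = trans (length-++ (fixedHead 0 (suc q)))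
                            (trans (+-identityʳ _) (length-map (put 0) (withPrefixes 0 q)))

  headCount-suc-0 : ∀ p → headCount (suc p) 0 ≡ count p 0 + headCount p 0
  headCount-suc-0 p = pairHead-length p 0

  headCount-suc-suc : ∀ p q → headCount (suc p) (suc q) ≡ count (suc p) q + (count p (suc q) + headCount p (suc q))
  headCount-suc-suc p q = trans (length-++ (fixedHead (suc p) (suc q)))
                                (cong₂ _+_ (length-map (put 0) (withPrefixes (suc p) q)) (pairHead-length p (suc q)))

  tailPairs-≤ : ∀ l a → tailPairs a ≤ pairs (l , a)
  tailPairs-≤ []      a = ≤-refl
  tailPairs-≤ (r ∷ l) a = ≤-trans (tailPairs-≤ l a) (m≤n+m _ (revPairs r))

  tailFixed-≤ : ∀ l a → tailFixed a ≤ fixed (l , a)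
  tailFixed-≤ []      a = ≤-refl
  tailFixed-≤ (r ∷ l) a = ≤-trans (tailFixed-≤ l a) (m≤n+m _ (revFixed r))

emptyTail : ℕ → ℕ → List ⊤
emptyTail zero    zero    = tt ∷ []
emptyTail zero    (suc _) = []
emptyTail (suc _) _       = []

module RevLists = Prefixed emptyTail (λ _ → 0) (λ _ → 0)

emptyTail-sound : ∀ {p q a} → a ∈ emptyTail p q → 0 ≡ p × 0 ≡ q
emptyTail-sound {zero}  {zero}  _ = refl , refl
emptyTail-sound {zero}  {suc _} ()
emptyTail-sound {suc _}         ()

emptyTail-unique : ∀ p q → Unique (emptyTail p q)
emptyTail-unique zero    zero    = [] ∷ []
emptyTail-unique zero    (suc _) = []
emptyTail-unique (suc _) _       = []

after4231 : ℕ → ℕ → List (List ℕ)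
after4231 (suc p) (suc (suc q)) = map proj₁ (RevLists.withPrefixes p q)
after4231 _       _             = []

-- A structure (l₁ , l₂) stands for the block sequence shape (l₁ , l₂); the block 4231 adds
-- one 2-cycle and two fixed points to those of l₂.
module Structures =
  Prefixed after4231 (λ l → suc (RevLists.pairs (l , tt))) (λ l → 2 + RevLists.fixed (l , tt))

after4231-sound : ∀ {p q l} → l ∈ after4231 p q → suc (RevLists.pairs (l , tt)) ≡ p × 2 + RevLists.fixed (l , tt) ≡ q
after4231-sound {suc p} {suc (suc q)} l∈ with ∈-map⁻ proj₁ l∈
... | (_ , tt) , x∈ , refl =
  let (p≡ , q≡) = RevLists.withPrefixes-sound emptyTail-sound x∈ in cong suc p≡ , cong (2 +_) q≡
after4231-sound {zero}                ()
after4231-sound {suc p} {zero}        ()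
after4231-sound {suc p} {suc zero}    ()

after4231-complete : ∀ l → l ∈ after4231 (suc (RevLists.pairs (l , tt))) (2 + RevLists.fixed (l , tt))
after4231-complete l = ∈-map⁺ proj₁ (RevLists.withPrefixes-complete (λ _ → here refl) l tt)

after4231-unique : ∀ p q → Unique (after4231 p q)
after4231-unique (suc p) (suc (suc q)) = Unique.map⁺ proj₁-injective (RevLists.withPrefixes-unique emptyTail-unique p q)
  where
  proj₁-injective : ∀ {x y : List ℕ × ⊤} → proj₁ x ≡ proj₁ y → x ≡ y
  proj₁-injective {_ , tt} {_ , tt} refl = refl
after4231-unique zero          _             = []
after4231-unique (suc p)       zero          = []
after4231-unique (suc p)       (suc zero)    = []

private
  interchange : ∀ a b c d → (2 * a + b) + (2 * c + d) ≡ 2 * (a + c) + (b + d)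
  interchange = solve-∀

size-revs : ∀ l → totalSize (map rev l) ≡ 2 * RevLists.pairs (l , tt) + RevLists.fixed (l , tt)
size-revs []      = refl
size-revs (r ∷ l) = trans (cong₂ _+_ (rev-size r) (size-revs l))
                           (interchange (revPairs r) (revFixed r) (RevLists.pairs (l , tt)) (RevLists.fixed (l , tt)))

fixed-revs : ∀ l → sum (map blockFixed (map rev l)) ≡ RevLists.fixed (l , tt)
fixed-revs []      = refl
fixed-revs (r ∷ l) = cong (revFixed r +_) (fixed-revs l)

size-shape : ∀ l₁ l₂ → totalSize (shape (l₁ , l₂)) ≡ 2 * Structures.pairs (l₁ , l₂) + Structures.fixed (l₁ , l₂)
size-shape []       l₂ = trans (cong (4 +_) (size-revs l₂)) (lemma _ _)
  where
  lemma : ∀ p f → 4 + (2 * p + f) ≡ 2 * suc p + (2 + f)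
  lemma = solve-∀
size-shape (r ∷ l₁) l₂ = trans (cong₂ _+_ (rev-size r) (size-shape l₁ l₂))
  (interchange (revPairs r) (revFixed r) (Structures.pairs (l₁ , l₂)) (Structures.fixed (l₁ , l₂)))

fixed-shape : ∀ l₁ l₂ → sum (map blockFixed (shape (l₁ , l₂))) ≡ Structures.fixed (l₁ , l₂)
fixed-shape []       l₂ = cong (2 +_) (fixed-revs l₂)
fixed-shape (r ∷ l₁) l₂ = cong (revFixed r +_) (fixed-shape l₁ l₂)

-- Counting block sequences

emptyTail-suc : ∀ p q → length (emptyTail p (suc q)) ≡ 0
emptyTail-suc zero    q = refl
emptyTail-suc (suc p) q = refl

revLists-zero : ∀ q → RevLists.count 0 q ≡ 1
revLists-zero zero    = refl
revLists-zero (suc q) = trans (RevLists.count-≡ 0 (suc q)) (trans (RevLists.headCount-0-suc q) (revLists-zero q))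

revLists-headCount : ∀ p q → RevLists.headCount p (suc q) ≡ RevLists.count p (suc q)
revLists-headCount p q = sym (trans (RevLists.count-≡ p (suc q)) (cong (_+ RevLists.headCount p (suc q)) (emptyTail-suc p q)))

revLists-row : ∀ a → RevLists.count (suc a) 0 ≡ 2 ^ a
revLists-row zero    = refl
revLists-row (suc a) = begin
  RevLists.count (2 + a) 0                             ≡⟨ RevLists.count-≡ (2 + a) 0 ⟩
  RevLists.headCount (2 + a) 0                         ≡⟨ RevLists.headCount-suc-0 (suc a) ⟩
  RevLists.count (1 + a) 0 + RevLists.headCount (1 + a) 0
    ≡⟨ cong (RevLists.count (1 + a) 0 +_) (sym (RevLists.count-≡ (1 + a) 0)) ⟩
  RevLists.count (1 + a) 0 + RevLists.count (1 + a) 0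
    ≡⟨ cong₂ _+_ (revLists-row a) (trans (revLists-row a) (sym (+-identityʳ _))) ⟩
  2 ^ suc a                                            ∎
  where open ≡-Reasoning

revLists-step : ∀ p q → RevLists.count (suc p) (suc q) ≡ RevLists.count (suc p) q + 2 * RevLists.count p (suc q)
revLists-step p q = begin
  RevLists.count (suc p) (suc q)      ≡⟨ RevLists.count-≡ (suc p) (suc q) ⟩
  RevLists.headCount (suc p) (suc q)  ≡⟨ RevLists.headCount-suc-suc p q ⟩
  RevLists.count (suc p) q + (RevLists.count p (suc q) + RevLists.headCount p (suc q))
    ≡⟨ cong (λ x → RevLists.count (suc p) q + (RevLists.count p (suc q) + x))
            (trans (revLists-headCount p q) (sym (+-identityʳ _))) ⟩
  RevLists.count (suc p) q + 2 * RevLists.count p (suc q) ∎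
  where open ≡-Reasoning

-- countΔ p q is RevLists.count p q minus RevLists.count (p − 1) q (taken as 0 when p = 0),
-- the coefficient of x^p y^q in (1 − x)² / (1 − 2x − y).
countΔ : ℕ → ℕ → ℕ
countΔ zero          q       = 1
countΔ (suc p)       (suc q) = 2 * countΔ p (suc q) + countΔ (suc p) q
countΔ 1             zero    = 0
countΔ (suc (suc p)) zero    = 2 ^ p

revLists-Δ : ∀ p q → RevLists.count (suc p) q ≡ RevLists.count p q + countΔ (suc p) q
revLists-Δ zero    zero    = refl
revLists-Δ (suc p) zero    = begin
  RevLists.count (2 + p) 0       ≡⟨ revLists-row (suc p) ⟩
  2 ^ p + (2 ^ p + 0)            ≡⟨ cong (2 ^ p +_) (+-identityʳ (2 ^ p)) ⟩
  2 ^ p + 2 ^ p                  ≡⟨ cong (_+ 2 ^ p) (sym (revLists-row p)) ⟩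
  RevLists.count (1 + p) 0 + 2 ^ p ∎
  where open ≡-Reasoning
revLists-Δ zero    (suc q) = begin
  RevLists.count 1 (suc q)                    ≡⟨ revLists-step 0 q ⟩
  RevLists.count 1 q + 2 * RevLists.count 0 (suc q)
    ≡⟨ cong₂ (λ x y → x + 2 * y) (revLists-Δ 0 q) (revLists-zero (suc q)) ⟩
  RevLists.count 0 q + countΔ 1 q + 2         ≡⟨ cong (λ x → x + countΔ 1 q + 2) (revLists-zero q) ⟩
  1 + countΔ 1 q + 2                          ≡⟨ cong suc (+-comm (countΔ 1 q) 2) ⟩
  1 + (2 + countΔ 1 q)                        ≡⟨ cong (_+ (2 + countΔ 1 q)) (sym (revLists-zero (suc q))) ⟩
  RevLists.count 0 (suc q) + countΔ 1 (suc q) ∎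
  where open ≡-Reasoning
revLists-Δ (suc p) (suc q) = begin
  RevLists.count (2 + p) (suc q)                         ≡⟨ revLists-step (suc p) q ⟩
  RevLists.count (2 + p) q + 2 * RevLists.count (1 + p) (suc q)
    ≡⟨ cong₂ (λ x y → x + 2 * y) (revLists-Δ (suc p) q) (revLists-step p q) ⟩
  (A + countΔ (2 + p) q) + 2 * (A + 2 * B)               ≡⟨ lemma A B (countΔ (2 + p) q) ⟩
  (A + 2 * B) + (2 * (A + B) + countΔ (2 + p) q)
    ≡⟨ cong₂ (λ x y → x + (2 * y + countΔ (2 + p) q)) (sym (revLists-step p q)) (sym Δ₁) ⟩
  RevLists.count (1 + p) (suc q) + countΔ (2 + p) (suc q) ∎
  where
  open ≡-Reasoning
  A = RevLists.count (1 + p) q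
  B = RevLists.count p (suc q)
  Δ₁ : countΔ (1 + p) (suc q) ≡ A + B
  Δ₁ = +-cancelˡ-≡ B _ _ (trans (sym (revLists-Δ p (suc q))) (trans (revLists-step p q) (lemma′ A B)))
    where
    lemma′ : ∀ a b → a + 2 * b ≡ b + (a + b)
    lemma′ = solve-∀
  lemma : ∀ a b d → (a + d) + 2 * (a + 2 * b) ≡ (a + 2 * b) + (2 * (a + b) + d)
  lemma = solve-∀

structures-0 : ∀ q → Structures.count 0 q ≡ 0
structures-0 q = length-≡-0 {xs = Structures.withPrefixes 0 q} λ {(l₁ , l₂)} x∈ →
  contradiction (proj₁ (Structures.withPrefixes-sound after4231-sound {0} {q} x∈))
                (<⇒≢ (≤-trans (s≤s z≤n) (Structures.tailPairs-≤ l₁ l₂)) ∘ sym)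

structures-fixed<2 : ∀ p {q} → q < 2 → Structures.count p q ≡ 0
structures-fixed<2 p {q} q<2 = length-≡-0 {xs = Structures.withPrefixes p q} λ {(l₁ , l₂)} x∈ →
  contradiction (proj₂ (Structures.withPrefixes-sound after4231-sound {p} {q} x∈))
                (<⇒≢ (<-≤-trans q<2 (≤-trans (m≤m+n 2 _) (Structures.tailFixed-≤ l₁ l₂))) ∘ sym)

after4231-length : ∀ p q → length (after4231 (suc p) (suc (suc q))) ≡ RevLists.count p q
after4231-length p q = length-map proj₁ (RevLists.withPrefixes p q)

structures-one : ∀ q → Structures.count 1 (2 + q) ≡ suc (Structures.count 1 (suc q))
structures-one q = begin
  Structures.count 1 (2 + q)                       ≡⟨ Structures.count-≡ 1 (2 + q) ⟩
  length (after4231 1 (2 + q)) + Structures.headCount 1 (2 + q)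
    ≡⟨ cong₂ _+_ (trans (after4231-length 0 q) (revLists-zero q)) (Structures.headCount-suc-suc 0 (suc q)) ⟩
  1 + (Structures.count 1 (suc q) + (Structures.count 0 (2 + q) + Structures.headCount 0 (2 + q)))
    ≡⟨ cong (λ x → 1 + (Structures.count 1 (suc q) + x))
            (cong₂ _+_ (structures-0 (2 + q)) (trans (sym (Structures.count-≡ 0 (2 + q))) (structures-0 (2 + q)))) ⟩
  1 + (Structures.count 1 (suc q) + 0)             ≡⟨ cong suc (+-identityʳ _) ⟩
  suc (Structures.count 1 (suc q))                 ∎
  where open ≡-Reasoning

structures-step : ∀ p q →
  Structures.count (2 + p) (2 + q) + RevLists.count p q
    ≡ RevLists.count (1 + p) q + (Structures.count (2 + p) (1 + q) + 2 * Structures.count (1 + p) (2 + q))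
structures-step p q = begin
  X (2 + p) (2 + q) + L p q
    ≡⟨ cong (_+ L p q) (trans (Structures.count-≡ (2 + p) (2 + q))
                              (cong₂ _+_ (after4231-length (suc p) q) (Structures.headCount-suc-suc (suc p) (suc q)))) ⟩
  L (1 + p) q + (X (2 + p) (1 + q) + (X (1 + p) (2 + q) + H)) + L p q
    ≡⟨ lemma (L (1 + p) q) (X (2 + p) (1 + q)) (X (1 + p) (2 + q)) H (L p q) ⟩
  L (1 + p) q + (X (2 + p) (1 + q) + (X (1 + p) (2 + q) + (L p q + H)))
    ≡⟨ cong (λ x → L (1 + p) q + (X (2 + p) (1 + q) + (X (1 + p) (2 + q) + x))) (sym X₁) ⟩
  L (1 + p) q + (X (2 + p) (1 + q) + (X (1 + p) (2 + q) + X (1 + p) (2 + q)))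
    ≡⟨ cong (λ x → L (1 + p) q + (X (2 + p) (1 + q) + (X (1 + p) (2 + q) + x))) (sym (+-identityʳ _)) ⟩
  L (1 + p) q + (X (2 + p) (1 + q) + 2 * X (1 + p) (2 + q)) ∎
  where
  open ≡-Reasoning
  L = RevLists.count
  X = Structures.count
  H = Structures.headCount (1 + p) (2 + q)
  X₁ : X (1 + p) (2 + q) ≡ L p q + H
  X₁ = trans (Structures.count-≡ (1 + p) (2 + q)) (cong (_+ H) (after4231-length p q))
  lemma : ∀ a b c h k → a + (b + (c + h)) + k ≡ a + (b + (c + (k + h)))
  lemma = solve-∀

structures-closed : ∀ p q → Structures.count (suc p) (suc q) ≡ q * countΔ p q
structures-closed zero    zero    = structures-fixed<2 1 ≤-refl
structures-closed zero    (suc q) = trans (structures-one q) (cong suc (structures-closed zero q))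
structures-closed (suc p) zero    = structures-fixed<2 (2 + p) ≤-refl
structures-closed (suc p) (suc q) = +-cancelʳ-≡ (RevLists.count p q) _ _ (begin
  Structures.count (2 + p) (2 + q) + RevLists.count p q
    ≡⟨ structures-step p q ⟩
  RevLists.count (1 + p) q + (Structures.count (2 + p) (1 + q) + 2 * Structures.count (1 + p) (2 + q))
    ≡⟨ cong₂ (λ x y → x + y) (revLists-Δ p q)
             (cong₂ (λ x y → x + 2 * y) (structures-closed (suc p) q) (structures-closed p (suc q))) ⟩
  (RevLists.count p q + countΔ (1 + p) q) + (q * countΔ (1 + p) q + 2 * (suc q * countΔ p (suc q)))
    ≡⟨ lemma (RevLists.count p q) (countΔ (1 + p) q) (countΔ p (suc q)) q ⟩
  suc q * countΔ (suc p) (suc q) + RevLists.count p q ∎)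
  where
  open ≡-Reasoning
  lemma : ∀ k d e q → (k + d) + (q * d + 2 * (suc q * e)) ≡ suc q * (2 * e + d) + k
  lemma = solve-∀

bracket : ℕ → ℕ → ℕ
bracket p m = m C p + 2 * ((m ∸ 1) C p) + (m ∸ 2) C p

bracket-pascal : ∀ a m → bracket (suc a) (3 + m) ≡ bracket a (2 + m) + bracket (suc a) (2 + m)
bracket-pascal a m = begin
  (3 + m) C suc a + 2 * ((2 + m) C suc a) + (1 + m) C suc a
    ≡⟨ sym (cong₂ (λ x y → x + 2 * y + (1 + m) C suc a) (pascal (2 + m)) (pascal (1 + m))) ⟩
  ((2 + m) C a + (2 + m) C suc a) + 2 * ((1 + m) C a + (1 + m) C suc a) + (1 + m) C suc a
    ≡⟨ cong (((2 + m) C a + (2 + m) C suc a) + 2 * ((1 + m) C a + (1 + m) C suc a) +_) (sym (pascal m)) ⟩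
  ((2 + m) C a + (2 + m) C suc a) + 2 * ((1 + m) C a + (1 + m) C suc a) + (m C a + m C suc a)
    ≡⟨ lemma ((2 + m) C a) ((2 + m) C suc a) ((1 + m) C a) ((1 + m) C suc a) (m C a) (m C suc a) ⟩
  ((2 + m) C a + 2 * ((1 + m) C a) + m C a) + ((2 + m) C suc a + 2 * ((1 + m) C suc a) + m C suc a) ∎
  where
  open ≡-Reasoning
  pascal : ∀ n → n C a + n C suc a ≡ suc n C suc a
  pascal n = nCk+nC[k+1]≡[n+1]C[k+1] n a
  lemma : ∀ x₁ y₁ x₂ y₂ x₃ y₃ → (x₁ + y₁) + 2 * (x₂ + y₂) + (x₃ + y₃) ≡ (x₁ + 2 * x₂ + x₃) + (y₁ + 2 * y₂ + y₃)
  lemma = solve-∀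

bracket-one : ∀ a → bracket (suc a) (suc (suc a + 0)) ≡ 4 + a
bracket-one a = begin
  bracket (suc a) (suc (suc (a + 0)))                          ≡⟨ cong (λ x → bracket (suc a) (suc (suc x))) (+-identityʳ a) ⟩
  (2 + a) C suc a + 2 * ((1 + a) C suc a) + a C suc a
    ≡⟨ cong₂ (λ x y → x + 2 * ((1 + a) C suc a) + y) top (k>n⇒nCk≡0 (n<1+n a)) ⟩
  (2 + a) + 2 * ((1 + a) C suc a) + 0                          ≡⟨ cong (λ x → (2 + a) + 2 * x + 0) (nCn≡1 (suc a)) ⟩
  (2 + a) + 2 + 0                                              ≡⟨ lemma a ⟩
  4 + a                                                        ∎
  where
  open ≡-Reasoning
  top : (2 + a) C suc a ≡ 2 + a
  top = trans (nCk≡nC[n∸k] (n≤1+n (suc a))) (trans (cong ((2 + a) C_) (m+n∸n≡m 1 a)) (nC1≡n (2 + a)))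
  lemma : ∀ a → (2 + a) + 2 + 0 ≡ 4 + a
  lemma = solve-∀

-- Both sides satisfy u (a + 1) (b + 1) ≡ 2 u a (b + 1) + u (a + 1) b, the right one by the
-- Pascal rule (bracket-pascal).
countΔ-closed : ∀ p q → 4 * countΔ p (suc q) ≡ 2 ^ p * bracket p (suc (p + q))
countΔ-closed zero          q    = refl
countΔ-closed 1             zero = refl
countΔ-closed (suc (suc a)) zero = begin
  4 * (2 * countΔ (suc a) 1 + 2 ^ a)                     ≡⟨ lemma (countΔ (suc a) 1) (2 ^ a) ⟩
  2 * (4 * countΔ (suc a) 1) + 4 * 2 ^ a                 ≡⟨ cong (λ x → 2 * x + 4 * 2 ^ a) (countΔ-closed (suc a) 0) ⟩
  2 * (2 ^ suc a * bracket (suc a) (suc (suc a + 0))) + 4 * 2 ^ a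
    ≡⟨ cong (λ x → 2 * (2 ^ suc a * x) + 4 * 2 ^ a) (bracket-one a) ⟩
  2 * (2 ^ suc a * (4 + a)) + 4 * 2 ^ a                  ≡⟨ lemma′ (2 ^ a) a ⟩
  2 ^ (2 + a) * (4 + suc a)                              ≡⟨ cong (2 ^ (2 + a) *_) (sym (bracket-one (suc a))) ⟩
  2 ^ (2 + a) * bracket (2 + a) (suc (2 + a + 0))        ∎
  where
  open ≡-Reasoning
  lemma : ∀ x y → 4 * (2 * x + y) ≡ 2 * (4 * x) + 4 * y
  lemma = solve-∀
  lemma′ : ∀ u a → 2 * (2 * u * (4 + a)) + 4 * u ≡ 2 * (2 * u) * (4 + suc a)
  lemma′ = solve-∀
countΔ-closed (suc a)       (suc q) = begin
  4 * (2 * countΔ a (2 + q) + countΔ (suc a) (suc q))     ≡⟨ lemma (countΔ a (2 + q)) (countΔ (suc a) (suc q)) ⟩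
  2 * (4 * countΔ a (2 + q)) + 4 * countΔ (suc a) (suc q)
    ≡⟨ cong₂ (λ x y → 2 * x + y) (countΔ-closed a (suc q)) (countΔ-closed (suc a) q) ⟩
  2 * (2 ^ a * bracket a (suc (a + suc q))) + 2 ^ suc a * bracket (suc a) (2 + (a + q))
    ≡⟨ cong (λ x → 2 * (2 ^ a * bracket a (suc x)) + 2 ^ suc a * bracket (suc a) (2 + (a + q))) (+-suc a q) ⟩
  2 * (2 ^ a * bracket a (2 + (a + q))) + 2 ^ suc a * bracket (suc a) (2 + (a + q))
    ≡⟨ lemma′ (2 ^ a) (bracket a (2 + (a + q))) (bracket (suc a) (2 + (a + q))) ⟩
  2 ^ suc a * (bracket a (2 + (a + q)) + bracket (suc a) (2 + (a + q)))
    ≡⟨ cong (2 ^ suc a *_) (sym (bracket-pascal a (a + q))) ⟩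
  2 ^ suc a * bracket (suc a) (3 + (a + q))
    ≡⟨ cong (λ x → 2 ^ suc a * bracket (suc a) (2 + x)) (sym (+-suc a q)) ⟩
  2 ^ suc a * bracket (suc a) (suc (suc a + suc q))        ∎
  where
  open ≡-Reasoning
  lemma : ∀ x y → 4 * (2 * x + y) ≡ 2 * (4 * x) + 4 * y
  lemma = solve-∀
  lemma′ : ∀ u x y → 2 * (u * x) + 2 * u * y ≡ 2 * u * (x + y)
  lemma′ = solve-∀

-- The closed formula

ℕtoℚ-mkℚ : ∀ a → ℕtoℚ a ≡ ℚ.mkℚ (ℤ.+ a) 0 (Coprime.sym (Coprime.1-coprimeTo a))
ℕtoℚ-mkℚ a = ℚ.normalize-coprime (Coprime.sym (Coprime.1-coprimeTo a))

ℕtoℚ-* : ∀ a b → ℕtoℚ (a * b) ≡ ℕtoℚ a ℚ.* ℕtoℚ b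
ℕtoℚ-* a b = sym (trans (cong₂ ℚ._*_ (ℕtoℚ-mkℚ a) (ℕtoℚ-mkℚ b)) (cong (ℚ._/ 1) (sym (ℤ.pos-* a b))))

*-cancelʳ-4 : ∀ {x y} → x ℚ.* ℕtoℚ 4 ≡ y ℚ.* ℕtoℚ 4 → x ≡ y
*-cancelʳ-4 {x} {y} eq = begin
  x                                  ≡⟨ sym (scale x) ⟩
  x ℚ.* ℕtoℚ 4 ℚ.* ℚ.1/ ℕtoℚ 4       ≡⟨ cong (ℚ._* ℚ.1/ ℕtoℚ 4) eq ⟩
  y ℚ.* ℕtoℚ 4 ℚ.* ℚ.1/ ℕtoℚ 4       ≡⟨ scale y ⟩
  y                                  ∎
  where
  open ≡-Reasoning
  scale : ∀ z → z ℚ.* ℕtoℚ 4 ℚ.* ℚ.1/ ℕtoℚ 4 ≡ z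
  scale z = trans (ℚ.*-assoc z _ _) (trans (cong (z ℚ.*_) (ℚ.*-inverseʳ (ℕtoℚ 4))) (ℚ.*-identityʳ z))

pow2-times-4 : ∀ p → pow2 (ℤ.+ suc p ℤ.- ℤ.+ 3) ℚ.* ℕtoℚ 4 ≡ ℕtoℚ (2 ^ p)
pow2-times-4 0             = refl
pow2-times-4 1             = refl
pow2-times-4 (suc (suc p)) = trans (sym (ℕtoℚ-* (2 ^ p) 4)) (cong ℕtoℚ (lemma (2 ^ p)))
  where
  lemma : ∀ u → u * 4 ≡ 2 * (2 * u)
  lemma = solve-∀

ℕtoℚ-quarter : ∀ p c x b → 4 * x ≡ c * (2 ^ p * b) → ℕtoℚ x ≡ ℕtoℚ c ℚ.* pow2 (ℤ.+ suc p ℤ.- ℤ.+ 3) ℚ.* ℕtoℚ b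
ℕtoℚ-quarter p c x b eq = *-cancelʳ-4 (begin
  ℕtoℚ x ℚ.* ℕtoℚ 4                       ≡⟨ sym (ℕtoℚ-* x 4) ⟩
  ℕtoℚ (x * 4)                            ≡⟨ cong ℕtoℚ (trans (*-comm x 4) eq) ⟩
  ℕtoℚ (c * (2 ^ p * b))                  ≡⟨ trans (ℕtoℚ-* c _) (cong (ℕtoℚ c ℚ.*_) (ℕtoℚ-* (2 ^ p) b)) ⟩
  Q ℚ.* (ℕtoℚ (2 ^ p) ℚ.* B)              ≡⟨ cong (λ z → Q ℚ.* (z ℚ.* B)) (sym (pow2-times-4 p)) ⟩
  Q ℚ.* (E ℚ.* F ℚ.* B)
    ≡⟨ cong (Q ℚ.*_) (trans (ℚ.*-assoc E F B) (trans (cong (E ℚ.*_) (ℚ.*-comm F B)) (sym (ℚ.*-assoc E B F)))) ⟩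
  Q ℚ.* (E ℚ.* B ℚ.* F)                   ≡⟨ sym (ℚ.*-assoc Q (E ℚ.* B) F) ⟩
  Q ℚ.* (E ℚ.* B) ℚ.* F                   ≡⟨ cong (ℚ._* F) (sym (ℚ.*-assoc Q E B)) ⟩
  Q ℚ.* E ℚ.* B ℚ.* F                     ∎)
  where
  open ≡-Reasoning
  Q = ℕtoℚ c
  B = ℕtoℚ b
  E = pow2 (ℤ.+ suc p ℤ.- ℤ.+ 3)
  F = ℕtoℚ 4

-- This holds for m < suc j too: both sides are then 1 for p = 0 and 0 otherwise.
binom-∸ : ∀ m j p → binom (ℤ.+ m ℤ.- ℤ.+ suc j) (ℤ.+ p) ≡ (m ∸ suc j) C p
binom-∸ m j zero    = refl
binom-∸ m j (suc p) with m <? suc j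
... | yes m<1+j = trans
  (cong (λ z → binom z (ℤ.+ suc p)) (trans (ℤ.⊖-< m<1+j) (cong (ℤ.-_ ∘ ℤ.+_) (+-∸-assoc 1 (≤-pred m<1+j)))))
  (cong (_C suc p) (sym (m≤n⇒m∸n≡0 (<⇒≤ m<1+j))))
... | no  m≮1+j = cong (λ z → binom z (ℤ.+ suc p)) (ℤ.⊖-≥ (≮⇒≥ m≮1+j))

binomials : ℕ → ℤ.ℤ → ℕ
binomials s h = binom (ℤ.+ s ℤ.- ℤ.+ 2) h + 2 * binom (ℤ.+ s ℤ.- ℤ.+ 3) h + binom (ℤ.+ s ℤ.- ℤ.+ 4) h

binomials≡bracket : ∀ p q → binomials (suc p + suc (suc q)) (ℤ.+ p) ≡ bracket p (suc (p + q))
binomials≡bracket p q = begin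
  binomials (suc p + suc (suc q)) (ℤ.+ p)
    ≡⟨ cong (λ s → binomials s (ℤ.+ p)) (cong suc (trans (+-suc p (suc q)) (cong suc (+-suc p q)))) ⟩
  binomials (3 + (p + q)) (ℤ.+ p)
    ≡⟨ combine (binom-∸ (3 + (p + q)) 1 p) (binom-∸ (3 + (p + q)) 2 p) (binom-∸ (3 + (p + q)) 3 p) ⟩
  bracket p (suc (p + q))
    ∎
  where
  open ≡-Reasoning
  combine : ∀ {a a′ b b′ c c′} → a ≡ a′ → b ≡ b′ → c ≡ c′ → a + 2 * b + c ≡ a′ + 2 * b′ + c′
  combine refl refl refl = refl

-- formulaEven n k unfolds to formula ((n + k) / 2) ((n ∸ k) / 2) k.
formula : ℕ → ℕ → ℕ → ℚ.ℚ
formula s p k = ℤtoℚ (ℤ.+ k ℤ.- ℤ.+ 1) ℚ.* pow2 (ℤ.+ p ℤ.- ℤ.+ 3) ℚ.* ℕtoℚ (binomials s (ℤ.+ p ℤ.- ℤ.+ 1))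

structures≡formula : ∀ p k → 4 ≤ 2 * p + k → ℕtoℚ (Structures.count p k) ≡ formula (p + k) p k
structures≡formula zero k _ = begin
  ℕtoℚ (Structures.count 0 k)  ≡⟨ cong ℕtoℚ (structures-0 k) ⟩
  ℚ.0ℚ                         ≡⟨ sym (ℚ.*-zeroʳ (ℤtoℚ (ℤ.+ k ℤ.- ℤ.+ 1) ℚ.* pow2 (ℤ.+ 0 ℤ.- ℤ.+ 3))) ⟩
  formula k 0 k                ∎
  where open ≡-Reasoning
-- The formula gives −1 for n = 2, k = 0; this is the case excluded by 4 ≤ n.
structures≡formula (suc zero)    zero (s≤s (s≤s ()))
structures≡formula (suc (suc p)) zero _ = begin
  ℕtoℚ (Structures.count (2 + p) 0)  ≡⟨ cong ℕtoℚ (structures-fixed<2 (2 + p) z<s) ⟩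
  ℚ.0ℚ                               ≡⟨ sym (ℚ.*-zeroʳ (ℤtoℚ (ℤ.+ 0 ℤ.- ℤ.+ 1) ℚ.* pow2 (ℤ.+ (2 + p) ℤ.- ℤ.+ 3))) ⟩
  ℤtoℚ (ℤ.+ 0 ℤ.- ℤ.+ 1) ℚ.* pow2 (ℤ.+ (2 + p) ℤ.- ℤ.+ 3) ℚ.* ℕtoℚ 0
    ≡⟨ cong (λ b → ℤtoℚ (ℤ.+ 0 ℤ.- ℤ.+ 1) ℚ.* pow2 (ℤ.+ (2 + p) ℤ.- ℤ.+ 3) ℚ.* ℕtoℚ b) (sym vanish) ⟩
  formula (2 + p + 0) (2 + p) 0      ∎
  where
  open ≡-Reasoning
  vanish : binomials (2 + p + 0) (ℤ.+ suc p) ≡ 0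
  vanish = combine (binom-∸ (2 + p + 0) 1 (suc p)) (binom-∸ (2 + p + 0) 2 (suc p)) (binom-∸ (2 + p + 0) 3 (suc p))
    where
    small : ∀ j → ((p + 0) ∸ j) C suc p ≡ 0
    small j = k>n⇒nCk≡0 (s≤s (≤-trans (m∸n≤m (p + 0) j) (≤-reflexive (+-identityʳ p))))
    combine : ∀ {a b c} → a ≡ ((p + 0) ∸ 0) C suc p → b ≡ ((p + 0) ∸ 1) C suc p → c ≡ ((p + 0) ∸ 2) C suc p →
              a + 2 * b + c ≡ 0
    combine refl refl refl rewrite small 0 | small 1 | small 2 = refl
structures≡formula (suc p) 1 _ = begin
  ℕtoℚ (Structures.count (suc p) 1)  ≡⟨ cong ℕtoℚ (structures-fixed<2 (suc p) ≤-refl) ⟩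
  ℚ.0ℚ                               ≡⟨ sym (ℚ.*-zeroˡ B) ⟩
  ℚ.0ℚ ℚ.* B                         ≡⟨ cong (ℚ._* B) (sym (ℚ.*-zeroˡ (pow2 (ℤ.+ suc p ℤ.- ℤ.+ 3)))) ⟩
  formula (suc p + 1) (suc p) 1      ∎
  where
  open ≡-Reasoning
  B = ℕtoℚ (binomials (suc p + 1) (ℤ.+ p))
structures≡formula (suc p) (suc (suc q)) _ = begin
  ℕtoℚ (Structures.count (suc p) (2 + q))
    ≡⟨ ℕtoℚ-quarter p (suc q) (Structures.count (suc p) (2 + q)) (bracket p (suc (p + q))) four-times ⟩
  ℕtoℚ (suc q) ℚ.* pow2 (ℤ.+ suc p ℤ.- ℤ.+ 3) ℚ.* ℕtoℚ (bracket p (suc (p + q)))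
    ≡⟨ cong (λ b → ℕtoℚ (suc q) ℚ.* pow2 (ℤ.+ suc p ℤ.- ℤ.+ 3) ℚ.* ℕtoℚ b) (sym (binomials≡bracket p q)) ⟩
  formula (suc p + (2 + q)) (suc p) (2 + q) ∎
  where
  open ≡-Reasoning
  four-times : 4 * Structures.count (suc p) (2 + q) ≡ suc q * (2 ^ p * bracket p (suc (p + q)))
  four-times = begin
    4 * Structures.count (suc p) (2 + q)   ≡⟨ cong (4 *_) (structures-closed p (suc q)) ⟩
    4 * (suc q * countΔ p (suc q))         ≡⟨ lemma (suc q) (countΔ p (suc q)) ⟩
    suc q * (4 * countΔ p (suc q))         ≡⟨ cong (suc q *_) (countΔ-closed p q) ⟩
    suc q * (2 ^ p * bracket p (suc (p + q))) ∎
    where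
    lemma : ∀ c d → 4 * (c * d) ≡ c * (4 * d)
    lemma = solve-∀

-- One-line notation

module _ {n : ℕ} (p : Fin n → Bool) where

  private
    foldr-∧ : List (Fin n) → Bool
    foldr-∧ = Data.List.foldr (λ i b → p i ∧ b) true

    foldr-∧⇒ : ∀ {xs} → T (foldr-∧ xs) → ∀ {i} → i ∈ xs → T (p i)
    foldr-∧⇒ t (here refl) = proj₁ (Equivalence.to Bool.T-∧ t)
    foldr-∧⇒ t (there i∈) = foldr-∧⇒ (proj₂ (Equivalence.to Bool.T-∧ t)) i∈

    foldr-∧⇐ : (∀ i → T (p i)) → ∀ xs → T (foldr-∧ xs)
    foldr-∧⇐ all []       = tt
    foldr-∧⇐ all (x ∷ xs) = Equivalence.from Bool.T-∧ (all x , foldr-∧⇐ all xs)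

  allB⇒ : T (allB p) → ∀ i → T (p i)
  allB⇒ t i = foldr-∧⇒ t (∈-allFin i)

  allB⇐ : (∀ i → T (p i)) → T (allB p)
  allB⇐ all = foldr-∧⇐ all (allFin n)

-- asFun π is the identity beyond n.
asFun : ∀ {n} → Vec (Fin n) n → ℕ → ℕ
asFun {n} π i with i <? n
... | yes i<n = toℕ (lookup π (fromℕ< i<n))
... | no  _   = i

module _ {n : ℕ} (π : Vec (Fin n) n) where

  asFun-toℕ : ∀ j → asFun π (toℕ j) ≡ toℕ (lookup π j)
  asFun-toℕ j with toℕ j <? n
  ... | yes j<n = cong (toℕ ∘ lookup π) (Fin.fromℕ<-toℕ j j<n)
  ... | no  j≮n = contradiction (Fin.toℕ<n j) j≮n

  asFun-fromℕ< : ∀ {i} (i<n : i < n) → asFun π i ≡ toℕ (lookup π (fromℕ< i<n))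
  asFun-fromℕ< {i} i<n = trans (cong (asFun π) (sym (Fin.toℕ-fromℕ< i<n))) (asFun-toℕ (fromℕ< i<n))

  isInvolution⇒ : T (isInvolution π) → InvolutionOn 0 n (asFun π)
  isInvolution⇒ t = record
    { lower      = λ _ _ → z≤n
    ; upper      = λ _ i<n → subst (_< n) (sym (asFun-fromℕ< i<n)) (Fin.toℕ<n _)
    ; involutive = λ {i} _ i<n → let j = fromℕ< i<n in begin
        asFun π (asFun π i)              ≡⟨ cong (asFun π) (asFun-fromℕ< i<n) ⟩
        asFun π (toℕ (lookup π j))       ≡⟨ asFun-toℕ (lookup π j) ⟩
        toℕ (lookup π (lookup π j))      ≡⟨ cong toℕ (toWitness (allB⇒ _ t j)) ⟩
        toℕ j                            ≡⟨ Fin.toℕ-fromℕ< i<n ⟩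
        i                                ∎
    }
    where open ≡-Reasoning

  isInvolution⇐ : InvolutionOn 0 n (asFun π) → T (isInvolution π)
  isInvolution⇐ inv = allB⇐ _ λ j → fromWitness (Fin.toℕ-injective (begin
    toℕ (lookup π (lookup π j))  ≡⟨ sym (asFun-toℕ (lookup π j)) ⟩
    asFun π (toℕ (lookup π j))   ≡⟨ cong (asFun π) (sym (asFun-toℕ j)) ⟩
    asFun π (asFun π (toℕ j))    ≡⟨ involutive inv z≤n (Fin.toℕ<n j) ⟩
    toℕ j                        ∎))
    where open ≡-Reasoning

  private
    fixedCount-tabulate : ∀ m s (e : Fin m → Fin n) → (∀ j → toℕ (e j) ≡ s + toℕ j) →
      length (filterᵇ (λ i → ⌊ lookup π i Fin.≟ i ⌋) (tabulate e)) ≡ fixedCount s m (asFun π)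
    fixedCount-tabulate zero    s e _     = refl
    fixedCount-tabulate (suc m) s e shift
      with fixedCount-tabulate m (suc s) (e ∘ Fin.suc) (λ j → trans (shift (Fin.suc j)) (+-suc s (toℕ j)))
         | trans (shift Fin.zero) (+-identityʳ s)
         | lookup π (e Fin.zero) Fin.≟ e Fin.zero | asFun π s ≟ s
    ... | rest | _  | yes _     | yes _     = cong suc rest
    ... | rest | _  | no  _     | no  _     = rest
    ... | _    | s≡ | yes fixed | no  moved =
      contradiction (trans (cong (asFun π) (sym s≡)) (trans (asFun-toℕ _) (trans (cong toℕ fixed) s≡))) moved
    ... | _    | s≡ | no  moved | yes fixed =
      contradiction (Fin.toℕ-injective (trans (sym (asFun-toℕ _)) (trans (cong (asFun π) s≡) (trans fixed (sym s≡))))) moved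

  fixedPoints≡ : fixedPoints π ≡ fixedCount 0 n (asFun π)
  fixedPoints≡ = fixedCount-tabulate n 0 (λ i → i) (λ _ → refl)

words≡cartesianProduct : ∀ m n → words (suc m) n ≡ cartesianProductWith (λ v i → i ∷ v) (words m n) (allFin n)
words≡cartesianProduct m n = go (words m n)
  where
  go : ∀ vs → concatMap (λ v → map (λ i → i ∷ v) (allFin n)) vs ≡ cartesianProductWith (λ v i → i ∷ v) vs (allFin n)
  go []       = refl
  go (v ∷ vs) = cong (map (λ i → i ∷ v) (allFin n) ++_) (go vs)

words-unique : ∀ m n → Unique (words m n)
words-unique zero    n = [] ∷ []
words-unique (suc m) n = subst Unique (sym (words≡cartesianProduct m n))
  (Unique.cartesianProductWith⁺ (λ v i → i ∷ v) (λ eq → swap (Vec.∷-injective eq)) (words-unique m n) (Unique.allFin⁺ n))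

words-complete : ∀ m n (v : Vec (Fin n) m) → v ∈ words m n
words-complete zero    n []      = here refl
words-complete (suc m) n (i ∷ v) = subst (i ∷ v ∈_) (sym (words≡cartesianProduct m n))
  (∈-cartesianProductWith⁺ (λ v i → i ∷ v) (words-complete m n v) (∈-allFin i))

toTriple : ∀ {n} → Vec (Fin n) 3 → Triple
toTriple (a ∷ b ∷ c ∷ []) = toℕ a , toℕ b , toℕ c

toTriple-injective : ∀ {n} {v w : Vec (Fin n) 3} → toTriple v ≡ toTriple w → v ≡ w
toTriple-injective {v = _ ∷ _ ∷ _ ∷ []} {_ ∷ _ ∷ _ ∷ []} eq =
  cong₂ _∷_ (Fin.toℕ-injective (cong proj₁ eq))
    (cong₂ _∷_ (Fin.toℕ-injective (cong (proj₁ ∘ proj₂) eq)) (cong (_∷ []) (Fin.toℕ-injective (cong (proj₂ ∘ proj₂) eq))))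

toTriple-onto : ∀ {n a b c} → a < n → b < n → c < n → ∃[ v ] toTriple {n} v ≡ (a , b , c)
toTriple-onto a<n b<n c<n = (fromℕ< a<n ∷ fromℕ< b<n ∷ fromℕ< c<n ∷ []) ,
  cong₂ _,_ (Fin.toℕ-fromℕ< a<n) (cong₂ _,_ (Fin.toℕ-fromℕ< b<n) (Fin.toℕ-fromℕ< c<n))

data Occ312 (n : ℕ) (g : ℕ → ℕ) : Triple → Set where
  occ : ∀ {a b c} → a < b → b < c → c < n → g b < g c → g c < g a → Occ312 n g (a , b , c)

isOcc : ∀ {n} → Vec (Fin 3) 3 → Vec (Fin n) n → Vec (Fin n) 3 → Bool
isOcc α π idx = strictlyIncreasing idx ∧ orderIso (Vec.map (lookup π) idx) α

module _ {n : ℕ} where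

  private
    <-from-does : ∀ {x y : Fin n} → ⌊ x Fin.<? y ⌋ ≡ true → x Fin.< y
    <-from-does eq = toWitness (Equivalence.from Bool.T-≡ eq)

    SameOrder : Vec (Fin n) 3 → Vec (Fin 3) 3 → Fin 3 → Fin 3 → Bool
    SameOrder w α j l = ⌊ ⌊ lookup w j Fin.<? lookup w l ⌋ Bool.≟ ⌊ lookup α j Fin.<? lookup α l ⌋ ⌋

    order⇒ : ∀ {w α} → T (orderIso w α) → ∀ j l →
             ⌊ lookup w j Fin.<? lookup w l ⌋ ≡ ⌊ lookup α j Fin.<? lookup α l ⌋
    order⇒ {w} {α} t j l = toWitness (allB⇒ (SameOrder w α j) (allB⇒ (λ j → allB (SameOrder w α j)) t j) l)

    order⇐ : ∀ {w α} → (∀ j l → ⌊ lookup w j Fin.<? lookup w l ⌋ ≡ ⌊ lookup α j Fin.<? lookup α l ⌋) →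
             T (orderIso w α)
    order⇐ {w} {α} same =
      allB⇐ (λ j → allB (SameOrder w α j)) λ j → allB⇐ (SameOrder w α j) λ l → fromWitness (same j l)

    Increasing : ∀ {m} → Vec (Fin n) m → Fin m → Fin m → Bool
    Increasing idx j l = not ⌊ j Fin.<? l ⌋ ∨ ⌊ lookup idx j Fin.<? lookup idx l ⌋

    ⌊⌋-true : ∀ {A : Set} {d : Dec A} → A → ⌊ d ⌋ ≡ true
    ⌊⌋-true {d = yes _} _ = refl
    ⌊⌋-true {d = no ¬a} a = contradiction a ¬a

    ⌊⌋-false : ∀ {A : Set} {d : Dec A} → ¬ A → ⌊ d ⌋ ≡ false
    ⌊⌋-false {d = yes a} ¬a = contradiction a ¬a
    ⌊⌋-false {d = no _}  _  = refl

    does-< : ∀ {x y : Fin n} → x Fin.< y → ⌊ x Fin.<? y ⌋ ≡ true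
    does-< = ⌊⌋-true

    does-≮ : ∀ {x y : Fin n} → y Fin.< x → ⌊ x Fin.<? y ⌋ ≡ false
    does-≮ y<x = ⌊⌋-false (<-asym y<x)

    does-irrefl : ∀ {x : Fin n} → ⌊ x Fin.<? x ⌋ ≡ false
    does-irrefl = ⌊⌋-false (<-irrefl refl)

  module _ (a b c : Fin n) where

    increasing⇒ : T (strictlyIncreasing (a ∷ b ∷ c ∷ [])) → a Fin.< b × b Fin.< c
    increasing⇒ t = toWitness (pair 0F 1F) , toWitness (pair 1F 2F)
      where
      pair : ∀ j l → T (Increasing (a ∷ b ∷ c ∷ []) j l)
      pair j l = allB⇒ (Increasing (a ∷ b ∷ c ∷ []) j) (allB⇒ (λ j → allB (Increasing (a ∷ b ∷ c ∷ []) j)) t j) l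

    increasing⇐ : a Fin.< b → b Fin.< c → T (strictlyIncreasing (a ∷ b ∷ c ∷ []))
    increasing⇐ a<b b<c =
      allB⇐ (λ j → allB (Increasing (a ∷ b ∷ c ∷ []) j)) λ j → allB⇐ (Increasing (a ∷ b ∷ c ∷ []) j) (table j)
      where
      table : ∀ j l → T (Increasing (a ∷ b ∷ c ∷ []) j l)
      table 0F 0F = tt
      table 0F 1F = fromWitness a<b
      table 0F 2F = fromWitness (<-trans a<b b<c)
      table 1F 0F = tt
      table 1F 1F = tt
      table 1F 2F = fromWitness b<c
      table 2F 0F = tt
      table 2F 1F = tt
      table 2F 2F = tt

  module _ (x y z : Fin n) where

    orderIso-231⇒ : T (orderIso (x ∷ y ∷ z ∷ []) p231) → z Fin.< x × x Fin.< y
    orderIso-231⇒ t = <-from-does (order⇒ {x ∷ y ∷ z ∷ []} {p231} t 2F 0F) ,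
                      <-from-does (order⇒ {x ∷ y ∷ z ∷ []} {p231} t 0F 1F)

    orderIso-231⇐ : z Fin.< x → x Fin.< y → T (orderIso (x ∷ y ∷ z ∷ []) p231)
    orderIso-231⇐ z<x x<y = order⇐ {x ∷ y ∷ z ∷ []} {p231} table
      where
      table : ∀ j l → ⌊ lookup (x ∷ y ∷ z ∷ []) j Fin.<? lookup (x ∷ y ∷ z ∷ []) l ⌋ ≡ ⌊ lookup p231 j Fin.<? lookup p231 l ⌋
      table 0F 0F = does-irrefl
      table 0F 1F = does-< x<y
      table 0F 2F = does-≮ z<x
      table 1F 0F = does-≮ x<y
      table 1F 1F = does-irrefl
      table 1F 2F = does-≮ (<-trans z<x x<y)
      table 2F 0F = does-< z<x
      table 2F 1F = does-< (<-trans z<x x<y)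
      table 2F 2F = does-irrefl

    orderIso-312⇒ : T (orderIso (x ∷ y ∷ z ∷ []) p312) → y Fin.< z × z Fin.< x
    orderIso-312⇒ t = <-from-does (order⇒ {x ∷ y ∷ z ∷ []} {p312} t 1F 2F) ,
                      <-from-does (order⇒ {x ∷ y ∷ z ∷ []} {p312} t 2F 0F)

    orderIso-312⇐ : y Fin.< z → z Fin.< x → T (orderIso (x ∷ y ∷ z ∷ []) p312)
    orderIso-312⇐ y<z z<x = order⇐ {x ∷ y ∷ z ∷ []} {p312} table
      where
      table : ∀ j l → ⌊ lookup (x ∷ y ∷ z ∷ []) j Fin.<? lookup (x ∷ y ∷ z ∷ []) l ⌋ ≡ ⌊ lookup p312 j Fin.<? lookup p312 l ⌋
      table 0F 0F = does-irrefl
      table 0F 1F = does-≮ (<-trans y<z z<x)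
      table 0F 2F = does-≮ z<x
      table 1F 0F = does-< (<-trans y<z z<x)
      table 1F 1F = does-irrefl
      table 1F 2F = does-< y<z
      table 2F 0F = does-< z<x
      table 2F 1F = does-≮ y<z
      table 2F 2F = does-irrefl

module _ {n : ℕ} (π : Vec (Fin n) n) where

  private
    g = asFun π

    value< : ∀ {a b} → toℕ (lookup π a) < toℕ (lookup π b) → g (toℕ a) < g (toℕ b)
    value< = subst₂ _<_ (sym (asFun-toℕ π _)) (sym (asFun-toℕ π _))

    value<⁻ : ∀ {a b} → g (toℕ a) < g (toℕ b) → toℕ (lookup π a) < toℕ (lookup π b)
    value<⁻ = subst₂ _<_ (asFun-toℕ π _) (asFun-toℕ π _)

    split : ∀ {α idx} → T (isOcc α π idx) → T (strictlyIncreasing idx) × T (orderIso (Vec.map (lookup π) idx) α)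
    split = Equivalence.to Bool.T-∧

    join : ∀ {α idx} → T (strictlyIncreasing idx) → T (orderIso (Vec.map (lookup π) idx) α) → T (isOcc α π idx)
    join inc iso = Equivalence.from Bool.T-∧ (inc , iso)

  occ231⇔ : ∀ idx → T (isOcc p231 π idx) ⇔ Occ231 0 n g (toTriple idx)
  occ231⇔ (a ∷ b ∷ c ∷ []) = mk⇔ to from
    where
    to : T (isOcc p231 π (a ∷ b ∷ c ∷ [])) → Occ231 0 n g (toTriple (a ∷ b ∷ c ∷ []))
    to t = let (inc , iso) = split {p231} {a ∷ b ∷ c ∷ []} t in
      let (a<b , b<c) = increasing⇒ a b c inc ; (gc<ga , ga<gb) = orderIso-231⇒ _ _ _ iso in
      occ z≤n a<b b<c (Fin.toℕ<n c) (value< gc<ga) (value< ga<gb)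
    from : Occ231 0 n g (toTriple (a ∷ b ∷ c ∷ [])) → T (isOcc p231 π (a ∷ b ∷ c ∷ []))
    from (occ _ a<b b<c _ gc<ga ga<gb) =
      join {p231} {a ∷ b ∷ c ∷ []} (increasing⇐ a b c a<b b<c) (orderIso-231⇐ _ _ _ (value<⁻ gc<ga) (value<⁻ ga<gb))

  occ312⇔ : ∀ idx → T (isOcc p312 π idx) ⇔ Occ312 n g (toTriple idx)
  occ312⇔ (a ∷ b ∷ c ∷ []) = mk⇔ to from
    where
    to : T (isOcc p312 π (a ∷ b ∷ c ∷ [])) → Occ312 n g (toTriple (a ∷ b ∷ c ∷ []))
    to t = let (inc , iso) = split {p312} {a ∷ b ∷ c ∷ []} t in
      let (a<b , b<c) = increasing⇒ a b c inc ; (gb<gc , gc<ga) = orderIso-312⇒ _ _ _ iso in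
      occ a<b b<c (Fin.toℕ<n c) (value< gb<gc) (value< gc<ga)
    from : Occ312 n g (toTriple (a ∷ b ∷ c ∷ [])) → T (isOcc p312 π (a ∷ b ∷ c ∷ []))
    from (occ a<b b<c _ gb<gc gc<ga) =
      join {p312} {a ∷ b ∷ c ∷ []} (increasing⇐ a b c a<b b<c) (orderIso-312⇐ _ _ _ (value<⁻ gb<gc) (value<⁻ gc<ga))

occ231-bounds : ∀ {s n g a b c} → Occ231 s n g (a , b , c) → a < n × b < n × c < n
occ231-bounds (occ _ a<b b<c c<n _ _) = <-trans a<b (<-trans b<c c<n) , <-trans b<c c<n , c<n

occ312-bounds : ∀ {n g a b c} → Occ312 n g (a , b , c) → a < n × b < n × c < n
occ312-bounds (occ a<b b<c c<n _ _) = <-trans a<b (<-trans b<c c<n) , <-trans b<c c<n , c<n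

unique312⇔unique231 : ∀ {n g} → InvolutionOn 0 n g → ∃! _≡_ (Occ312 n g) ⇔ Unique231 0 n g
unique312⇔unique231 {n} {g} inv = ∃!-bijection f preserves onto injective′
  where
  f : Triple → Triple
  f (a , b , c) = g b , g c , g a
  gg : ∀ {i} → i < n → g (g i) ≡ i
  gg = involutive inv z≤n
  g< : ∀ {i j} → i < n → j < n → i < j → g (g i) < g (g j)
  g< i<n j<n = subst₂ _<_ (sym (gg i<n)) (sym (gg j<n))
  preserves : ∀ {t} → Occ312 n g t → Occ231 0 n g (f t)
  preserves o@(occ a<b b<c c<n gb<gc gc<ga) =
    let (a<n , b<n , _) = occ312-bounds o in
    occ z≤n gb<gc gc<ga (upper inv z≤n a<n) (g< a<n b<n a<b) (g< b<n c<n b<c)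
  onto : ∀ {t} → Occ231 0 n g t → ∃[ t′ ] Occ312 n g t′ × f t′ ≡ t
  onto o@(occ _ x<y y<z z<n gz<gx gx<gy) =
    let (x<n , y<n , _) = occ231-bounds o in
    _ , occ gz<gx gx<gy (upper inv z≤n y<n) (g< x<n y<n x<y) (g< y<n z<n y<z) ,
    cong₂ _,_ (gg x<n) (cong₂ _,_ (gg y<n) (gg z<n))
  injective′ : ∀ {t t′} → Occ312 n g t → Occ312 n g t′ → f t ≡ f t′ → t ≡ t′
  injective′ o o′ eq =
    let (a<n , b<n , c<n) = occ312-bounds o ; (a′<n , b′<n , c′<n) = occ312-bounds o′ in
    cong₂ _,_ (injective inv z≤n a<n z≤n a′<n (cong (proj₂ ∘ proj₂) eq))
      (cong₂ _,_ (injective inv z≤n b<n z≤n b′<n (cong proj₁ eq))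
                 (injective inv z≤n c<n z≤n c′<n (cong (proj₁ ∘ proj₂) eq)))

module _ {n : ℕ} (π : Vec (Fin n) n) where

  private
    via-triples : ∀ {α} {Q : Triple → Set} → (∀ idx → T (isOcc α π idx) ⇔ Q (toTriple idx)) →
                  (∀ {a b c} → Q (a , b , c) → a < n × b < n × c < n) → ∃! _≡_ (T ∘ isOcc α π) ⇔ ∃! _≡_ Q
    via-triples {α} {Q} occ⇔ bounded =
      ∃!-bijection toTriple (Equivalence.to (occ⇔ _)) onto (λ _ _ → toTriple-injective)
      where
      onto : ∀ {t} → Q t → ∃[ idx ] T (isOcc α π idx) × toTriple idx ≡ t
      onto {a , b , c} q = let (a<n , b<n , c<n) = bounded q ; (idx , idx≡) = toTriple-onto a<n b<n c<n in
        idx , Equivalence.from (occ⇔ idx) (subst Q (sym idx≡) q) , idx≡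

    counted : ∀ α → occurrences α π ≡ 1 ⇔ ∃! _≡_ (T ∘ isOcc α π)
    counted α = length-filterᵇ≡1⇔ (words-unique 3 n) (words-complete 3 n) (isOcc α π)

  occurrences≡1⇔ : ∀ α → α ≡ p231 ⊎ α ≡ p312 → InvolutionOn 0 n (asFun π) →
                   occurrences α π ≡ 1 ⇔ Unique231 0 n (asFun π)
  occurrences≡1⇔ .p231 (inj₁ refl) _   = via-triples {p231} (occ231⇔ π) occ231-bounds ⇔-∘ counted p231
  occurrences≡1⇔ .p312 (inj₂ refl) inv =
    unique312⇔unique231 inv ⇔-∘ (via-triples {p312} (occ312⇔ π) occ312-bounds ⇔-∘ counted p312)

-- The junk value i is returned when x ≥ n.
clamp : ∀ {n} → Fin n → ℕ → Fin n
clamp {n} i x with x <? n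
... | yes x<n = fromℕ< x<n
... | no  _   = i

toℕ-clamp : ∀ {n} (i : Fin n) {x} → x < n → toℕ (clamp i x) ≡ x
toℕ-clamp {n} i {x} x<n with x <? n
... | yes x<n′ = Fin.toℕ-fromℕ< x<n′
... | no  x≮n  = contradiction x<n x≮n

realize : ∀ n → (ℕ → ℕ) → Vec (Fin n) n
realize n g = Vec.tabulate (λ i → clamp i (g (toℕ i)))

module _ {n : ℕ} {g : ℕ → ℕ} where

  asFun-realize : (∀ {i} → i < n → g i < n) → AgreeOn 0 n (asFun (realize n g)) g
  asFun-realize bounded {i} _ i<n = begin
    asFun (realize n g) i                             ≡⟨ asFun-fromℕ< (realize n g) i<n ⟩
    toℕ (lookup (realize n g) (fromℕ< i<n))           ≡⟨ cong toℕ (Vec.lookup∘tabulate _ (fromℕ< i<n)) ⟩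
    toℕ (clamp (fromℕ< i<n) (g (toℕ (fromℕ< i<n))))  ≡⟨ cong (λ x → toℕ (clamp (fromℕ< i<n) (g x))) (Fin.toℕ-fromℕ< i<n) ⟩
    toℕ (clamp (fromℕ< i<n) (g i))                    ≡⟨ toℕ-clamp _ (bounded i<n) ⟩
    g i                                               ∎
    where open ≡-Reasoning

  realize-asFun : (π : Vec (Fin n) n) → AgreeOn 0 n (asFun π) g → π ≡ realize n g
  realize-asFun π agree = trans (sym (Vec.tabulate∘lookup π)) (Vec.tabulate-cong λ j → Fin.toℕ-injective (begin
    toℕ (lookup π j)           ≡⟨ sym (asFun-toℕ π j) ⟩
    asFun π (toℕ j)            ≡⟨ agree z≤n (Fin.toℕ<n j) ⟩
    g (toℕ j)                  ≡⟨ sym (toℕ-clamp j (subst (_< n) (trans (sym (asFun-toℕ π j)) (agree z≤n (Fin.toℕ<n j)))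
                                                              (Fin.toℕ<n (lookup π j)))) ⟩
    toℕ (clamp j (g (toℕ j)))  ∎))
    where open ≡-Reasoning

Counted : ∀ {n} → Vec (Fin 3) 3 → ℕ → Vec (Fin n) n → Bool
Counted α k π = ⌊ fixedPoints π ≟ k ⌋ ∧ ⌊ occurrences α π ≟ 1 ⌋

module _ {n : ℕ} {α : Vec (Fin 3) 3} {k : ℕ} {π : Vec (Fin n) n} where

  Counted⇒ : T (Counted α k π) → fixedPoints π ≡ k × occurrences α π ≡ 1
  Counted⇒ t = let (f , o) = Equivalence.to (Bool.T-∧ {⌊ fixedPoints π ≟ k ⌋} {⌊ occurrences α π ≟ 1 ⌋}) t in
    toWitness f , toWitness o

  Counted⇐ : fixedPoints π ≡ k → occurrences α π ≡ 1 → T (Counted α k π)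
  Counted⇐ f o = Equivalence.from (Bool.T-∧ {⌊ fixedPoints π ≟ k ⌋} {⌊ occurrences α π ≟ 1 ⌋})
                                  (fromWitness f , fromWitness o)

realizeShape : ∀ n → List ℕ × List ℕ → Vec (Fin n) n
realizeShape n st = realize n (⟦ shape st ⟧ 0)

⟦shape⟧-bounded : ∀ {n} l₁ l₂ → totalSize (shape (l₁ , l₂)) ≡ n → ∀ {i} → i < n → ⟦ shape (l₁ , l₂) ⟧ 0 i < n
⟦shape⟧-bounded l₁ l₂ size≡ = subst (λ m → ∀ {i} → i < m → ⟦ shape (l₁ , l₂) ⟧ 0 i < m) size≡
                                   (upper (proj₁ (⟦shape⟧-unique231 l₁ l₂ 0)) z≤n)

realizeShape-injective : ∀ {n st st′} → totalSize (shape st) ≡ n → totalSize (shape st′) ≡ n →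
                         realizeShape n st ≡ realizeShape n st′ → st ≡ st′
realizeShape-injective {n} {l₁ , l₂} {l₁′ , l₂′} size≡ size≡′ eq =
  shape-injective (⟦⟧-injective (shape (l₁ , l₂)) (shape (l₁′ , l₂′)) (trans size≡ (sym size≡′)) λ {i} _ i<size →
    let i<n = subst (i <_) size≡ i<size in
    trans (sym (asFun-realize (⟦shape⟧-bounded l₁ l₂ size≡) z≤n i<n))
          (trans (cong (λ π → asFun π i) eq) (asFun-realize (⟦shape⟧-bounded l₁′ l₂′ size≡′) z≤n i<n)))

module Counting {α : Vec (Fin 3) 3} (α-is : α ≡ p231 ⊎ α ≡ p312) {n k : ℕ} where

  decompose : (π : Vec (Fin n) n) → T (isInvolution π) → T (Counted α k π) →
              ∃[ st ] totalSize (shape st) ≡ n × Structures.fixed st ≡ k × π ≡ realizeShape n st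
  decompose π isInv counted = st , size≡ , fixed≡k , realize-asFun π agree
    where
    inv : InvolutionOn 0 n (asFun π)
    inv = isInvolution⇒ π isInv
    parts : fixedPoints π ≡ k × occurrences α π ≡ 1
    parts = Counted⇒ {α = α} {k} {π} counted
    unique : Unique231 0 n (asFun π)
    unique = Equivalence.to (occurrences≡1⇔ π α α-is inv) (proj₂ parts)
    decomposition = Decomposition.decompose-unique (<-wellFounded (n ∸ 0)) inv unique
    st = proj₁ decomposition
    size≡ = proj₁ (proj₂ decomposition)
    agree = proj₂ (proj₂ decomposition)
    fixed≡k : Structures.fixed st ≡ k
    fixed≡k = begin
      Structures.fixed st                                   ≡⟨ sym (fixed-shape (proj₁ st) (proj₂ st)) ⟩
      sum (map blockFixed (shape st))                       ≡⟨ sym (fixedCount-⟦⟧ (shape st) 0) ⟩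
      fixedCount 0 (totalSize (shape st)) (⟦ shape st ⟧ 0) ≡⟨ cong (λ m → fixedCount 0 m (⟦ shape st ⟧ 0)) size≡ ⟩
      fixedCount 0 n (⟦ shape st ⟧ 0)                       ≡⟨ sym (fixedCount-cong 0 n agree) ⟩
      fixedCount 0 n (asFun π)                              ≡⟨ sym (fixedPoints≡ π) ⟩
      fixedPoints π                                         ≡⟨ proj₁ parts ⟩
      k                                                     ∎
      where open ≡-Reasoning

  realization : ∀ st → totalSize (shape st) ≡ n → Structures.fixed st ≡ k →
                T (isInvolution (realizeShape n st)) × T (Counted α k (realizeShape n st))
  realization (l₁ , l₂) size≡ fixed =
    isInvolution⇐ π inv′ , Counted⇐ {α = α} {k} {π} fixedPoints≡k occurrences≡1
    where
    g = ⟦ shape (l₁ , l₂) ⟧ 0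
    π = realize n g
    inv : InvolutionOn 0 n g
    inv = subst (λ m → InvolutionOn 0 m g) size≡ (proj₁ (⟦shape⟧-unique231 l₁ l₂ 0))
    agree : AgreeOn 0 n (asFun π) g
    agree = asFun-realize (upper inv z≤n)
    inv′ : InvolutionOn 0 n (asFun π)
    inv′ = InvolutionOn-cong (λ s≤i i<n → sym (agree s≤i i<n)) inv
    unique′ : Unique231 0 n (asFun π)
    unique′ with subst (λ m → Unique231 0 m g) size≡ (proj₂ (⟦shape⟧-unique231 l₁ l₂ 0))
    ... | t , o , only = t , Occ231-cong (λ s≤i i<n → sym (agree s≤i i<n)) o , only ∘ Occ231-cong agree
    occurrences≡1 = Equivalence.from (occurrences≡1⇔ π α α-is inv′) unique′
    fixedPoints≡k : fixedPoints π ≡ k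
    fixedPoints≡k = begin
      fixedPoints π                              ≡⟨ fixedPoints≡ π ⟩
      fixedCount 0 n (asFun π)                   ≡⟨ fixedCount-cong 0 n agree ⟩
      fixedCount 0 n g                           ≡⟨ cong (λ m → fixedCount 0 m g) (sym size≡) ⟩
      fixedCount 0 (totalSize (shape (l₁ , l₂))) g ≡⟨ fixedCount-⟦⟧ (shape (l₁ , l₂)) 0 ⟩
      sum (map blockFixed (shape (l₁ , l₂)))     ≡⟨ fixed-shape l₁ l₂ ⟩
      Structures.fixed (l₁ , l₂)                 ≡⟨ fixed ⟩
      k                                          ∎
      where open ≡-Reasoning

  private
    involutions-unique : Unique (involutions n)
    involutions-unique = Unique.filter⁺ (T? ∘ isInvolution) (words-unique n n)

    ∈-involutions⁻ : ∀ {π} → π ∈ involutions n → T (isInvolution π)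
    ∈-involutions⁻ π∈ = proj₂ (∈-filter⁻ (T? ∘ isInvolution) {xs = words n n} π∈)

    ∈-involutions⁺ : ∀ {π} → T (isInvolution π) → π ∈ involutions n
    ∈-involutions⁺ {π} = ∈-filter⁺ (T? ∘ isInvolution) (words-complete n n π)

    size≡2p+k : ∀ st → Structures.fixed st ≡ k → totalSize (shape st) ≡ 2 * Structures.pairs st + k
    size≡2p+k (l₁ , l₂) fixed = trans (size-shape l₁ l₂) (cong (2 * Structures.pairs (l₁ , l₂) +_) fixed)

  invCount-vanishes : (∀ p → n ≢ 2 * p + k) → invCount n k α ≡ 0
  invCount-vanishes no-p = length-≡-0 {xs = filterᵇ (Counted α k) (involutions n)} λ {π} π∈ →
    let (π∈involutions , counted) = ∈-filter⁻ (T? ∘ Counted α k) {xs = involutions n} π∈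
        (st , size≡ , fixed , _) = decompose π (∈-involutions⁻ π∈involutions) counted
    in no-p (Structures.pairs st) (trans (sym size≡) (size≡2p+k st fixed))

  module _ (p : ℕ) (n≡ : n ≡ 2 * p + k) where

    private
      stats : ∀ {st} → st ∈ Structures.withPrefixes p k → Structures.pairs st ≡ p × Structures.fixed st ≡ k
      stats = Structures.withPrefixes-sound after4231-sound

      has-size : ∀ {st} → st ∈ Structures.withPrefixes p k → totalSize (shape st) ≡ n
      has-size {st} st∈ = let (pairs≡ , fixed≡) = stats st∈ in
        trans (size≡2p+k st fixed≡) (trans (cong (λ x → 2 * x + k) pairs≡) (sym n≡))

    realized-unique : Unique (map (realizeShape n) (Structures.withPrefixes p k))
    realized-unique = Unique-map-on (realizeShape n) has-size realizeShape-injective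
      (Structures.withPrefixes-unique after4231-unique p k)

    realized-sound : ∀ {π} → π ∈ map (realizeShape n) (Structures.withPrefixes p k) →
                     π ∈ involutions n × T (Counted α k π)
    realized-sound π∈ =
      let (st , st∈ , π≡) = ∈-map⁻ (realizeShape n) π∈
          (isInv , counted) = realization st (has-size st∈) (proj₂ (stats st∈))
      in subst (λ π → π ∈ involutions n × T (Counted α k π)) (sym π≡) (∈-involutions⁺ isInv , counted)

    realized-complete : ∀ {π} → π ∈ involutions n → T (Counted α k π) →
                        π ∈ map (realizeShape n) (Structures.withPrefixes p k)
    realized-complete {π} π∈ counted =
      let ((l₁ , l₂) , size≡ , fixed , π≡) = decompose π (∈-involutions⁻ π∈) counted
          pairs≡p = *-cancelˡ-≡ _ _ 2 (+-cancelʳ-≡ k _ _ (trans (sym (size≡2p+k (l₁ , l₂) fixed)) (trans size≡ n≡)))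
      in subst (_∈ map (realizeShape n) (Structures.withPrefixes p k)) (sym π≡) (∈-map⁺ (realizeShape n)
           (subst₂ (λ p′ k′ → (l₁ , l₂) ∈ Structures.withPrefixes p′ k′) pairs≡p fixed
                   (Structures.withPrefixes-complete after4231-complete l₁ l₂)))

  invCount≡structures : ∀ p → n ≡ 2 * p + k → invCount n k α ≡ Structures.count p k
  invCount≡structures p n≡ =
    trans (length-filterᵇ (Counted α k) involutions-unique
                          (realized-unique p n≡) (realized-sound p n≡) (realized-complete p n≡))
          (length-map (realizeShape n) (Structures.withPrefixes p k))

private
  even-split : ∀ {n k} → k ≤ n → (n + k) % 2 ≡ 0 → n ≡ 2 * ((n ∸ k) / 2) + k
  even-split {n} {k} k≤n n+k-even = begin
    n                      ≡⟨ sym (m∸n+n≡m k≤n) ⟩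
    d + k                  ≡⟨ cong (_+ k) (trans (m≡m%n+[m/n]*n d 2) (trans (cong (_+ (d / 2) * 2) d-even) (*-comm (d / 2) 2))) ⟩
    2 * (d / 2) + k        ∎
    where
    open ≡-Reasoning
    d = n ∸ k
    d-even : d % 2 ≡ 0
    d-even = trans (sym ([m+kn]%n≡m%n d k 2))
                   (trans (cong (_% 2) (trans (cong (d +_) (*-comm k 2)) (trans (lemma d k) (cong (_+ k) (m∸n+n≡m k≤n)))))
                          n+k-even)
      where
      lemma : ∀ d k → d + 2 * k ≡ d + k + k
      lemma = solve-∀

  doubled : ∀ p k → 2 * p + k + k ≡ (p + k) * 2
  doubled = solve-∀

  half-sum : ∀ {n k} p → n ≡ 2 * p + k → (n + k) / 2 ≡ p + k
  half-sum {k = k} p refl = trans (cong (_/ 2) (doubled p k)) (m*n/n≡m (p + k) 2)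

  odd-impossible : ∀ {n k} p → n ≡ 2 * p + k → (n + k) % 2 ≢ 1
  odd-impossible {k = k} p refl n+k-odd =
    0≢1+n (trans (sym (m*n%n≡0 (p + k) 2)) (trans (cong (_% 2) (sym (doubled p k))) n+k-odd))

theorem3p5 : (α : Vec (Fin 3) 3) → α ≡ p231 ⊎ α ≡ p312 →
    (n k : ℕ) → 4 ≤ n → k ≤ n →
    ((n + k) % 2 ≡ 0 → ℕtoℚ (invCount n k α) ≡ formulaEven n k)
    × ((n + k) % 2 ≡ 1 → invCount n k α ≡ 0)
theorem3p5 α α-is n k 4≤n k≤n = even , odd
  where
  open Counting α-is {n} {k}

  even : (n + k) % 2 ≡ 0 → ℕtoℚ (invCount n k α) ≡ formulaEven n k
  even n+k-even = begin
    ℕtoℚ (invCount n k α)        ≡⟨ cong ℕtoℚ (invCount≡structures p n≡) ⟩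
    ℕtoℚ (Structures.count p k)  ≡⟨ structures≡formula p k (subst (4 ≤_) n≡ 4≤n) ⟩
    formula (p + k) p k          ≡⟨ cong (λ s → formula s p k) (sym (half-sum p n≡)) ⟩
    formulaEven n k              ∎
    where
    open ≡-Reasoning
    p = (n ∸ k) / 2
    n≡ = even-split k≤n n+k-even

  odd : (n + k) % 2 ≡ 1 → invCount n k α ≡ 0
  odd n+k-odd = invCount-vanishes λ p n≡ → odd-impossible p n≡ n+k-odd
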